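{- Let $\mathbb T$ be a CSC-theory. Then the syntactic quadruple $(S(\mathbb T),\mathcal T,\mathcal S,\iota)$ is a CSC-model, and the canonical interpretation of $\mathbb T$ in it (sending each type $A$ to $[A]$ and each term to its equivalence class) is sound and complete: $\vdash A=B:\mathtt{type}$ is derivable in $\mathbb T$ iff $[\![A]\!]=[\![B]\!]$, and $\Gamma\vdash M=N:A$ is derivable in $\mathbb T$ iff $[\![\Gamma\vdash M:A]\!]=[\![\Gamma\vdash N:A]\!]$.
   Context: CSC (Central Submonad Calculus): types $A,B::=G\mid 1\mid A\to B\mid A\times B\mid\mathcal SA\mid\mathcal TA$; terms $x\mid *\mid\lambda x^A.M\mid MN\mid\langle M,N\rangle\mid\pi_iM\mid\mathtt{ret}_{\mathcal X}M\mid\iota M\mid\mathtt{do}_{\mathcal X}x\leftarrow M;N$ ($\mathcal X\in\{\mathcal S,\mathcal T\}$), typed by the usual simply-typed rules plus $\mathtt{ret}_{\mathcal X}:A\Rightarrow\mathcal XA$, $\iota:\mathcal SA\Rightarrow\mathcal TA$, and $\Gamma\vdash M:\mathcal XA$, $\Gamma,x:A\vdash N:\mathcal XB$ give $\Gamma\vdash\mathtt{do}_{\mathcal X}x\leftarrow M;N:\mathcal XB$; judgements closed under weakening. Type equality is a congruent equivalence relation respected by typing. Term equality is a congruent equivalence relation closed under substitution and weakening containing the $\beta\eta$ laws for $1,\times,\to$; for each $\mathcal X$ the monad laws ($\mathtt{do}_{\mathcal X}x\leftarrow\mathtt{ret}_{\mathcal X}M;N=N[M/x]$, $\mathtt{do}_{\mathcal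 X}x\leftarrow M;\mathtt{ret}_{\mathcal X}x=M$, associativity $\mathtt{do}_{\mathcal X}y\leftarrow(\mathtt{do}_{\mathcal X}x\leftarrow M;N);P=\mathtt{do}_{\mathcal X}x\leftarrow M;\mathtt{do}_{\mathcal X}y\leftarrow N;P$); centrality $\mathtt{do}_{\mathcal T}x\leftarrow\iota M;\mathtt{do}_{\mathcal T}y\leftarrow N;P=\mathtt{do}_{\mathcal T}y\leftarrow N;\mathtt{do}_{\mathcal T}x\leftarrow\iota M;P$ for $M:\mathcal SA$, $N:\mathcal TB$; $\iota M=\iota N$ iff $M=N$; $\mathtt{do}_{\mathcal T}x\leftarrow\iota M;\iota N=\iota(\mathtt{do}_{\mathcal S}x\leftarrow M;N)$; $\iota(\mathtt{ret}_{\mathcal S}M)=\mathtt{ret}_{\mathcal T}M$. A CSC-theory extends CSC by new ground types, term constants (well-formed in every context) and type/term equality axioms. $S(\mathbb T)$ is the category of types modulo type equality and judgements $x:A\vdash f:B$ modulo provable equality, with composition by substitution; on it $\mathcal X[A]=[\mathcal XA]$, $\eta^{\mathcal X}=[x\vdash\mathtt{ret}_{\mathcal X}x]$, $\mu^{\mathcal X}=[x\vdash\mathtt{do}_{\mathcal X}y\leftarrow x;y]$, $\tau^{\mathcal X}=[x\vdash\mathtt{do}_{\mathcal X}y\leftarrow\pi_2x;\mathtt{ret}_{\mathcal X}\langle\pi_1x,y\rangle]$, $\iota_{[A]}=[x:\mathcal SA\vdash\iota x:\mathcal TA]$. A CSC-model is a cartesian closed category with a strong monad $\mathcal T$ and a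 central submonad $\mathcal S$ (strong submonad $\iota:\mathcal S\Rightarrow\mathcal T$, monic morphism of strong monads, such that every $(\mathcal SX,\iota_X)$ is a central cone: $\mu\circ\mathcal T\tau'\circ\tau\circ(\iota_X\times\mathrm{id})=\mu\circ\mathcal T\tau\circ\tau'\circ(\iota_X\times\mathrm{id}):\mathcal SX\times\mathcal TY\to\mathcal T(X\times Y)$ for all $Y$, $\tau'$ the right strength). An interpretation maps ground types to objects, $1,\to,\times,\mathcal S,\mathcal T$ to terminal object, exponential, product, $\mathcal S,\mathcal T$, contexts to products, and terms $\Gamma\vdash M:A$ to morphisms $[\![\Gamma]\!]\to[\![A]\!]$ in the standard way for the $\lambda$-calculus, with $[\![\mathtt{ret}_{\mathcal X}M]\!]=\eta^{\mathcal X}\circ[\![M]\!]$, $[\![\iota M]\!]=\iota\circ[\![M]\!]$, $[\![\mathtt{do}_{\mathcal X}x\leftarrow M;N]\!]=\mu^{\mathcal X}\circ\mathcal X[\![N]\!]\circ\tau^{\mathcal X}\circ\langle\mathrm{id},[\![M]\!]\rangle$. -}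

module Defs where

-- De Bruijn indices are used for variables;
-- a context is a list of types whose head is the variable with index 0.

open import Data.Nat using (ℕ; zero; suc)
open import Data.List using (List; []; _∷_)
open import Data.Product using (Σ; _,_; proj₁; proj₂)
open import Relation.Binary using (IsEquivalence)
import Relation.Binary.PropositionalEquality as PE

data Mon : Set where
  𝒮 𝒯 : Mon

data Ty (G : Set) : Set where
  gnd  : G → Ty G
  𝟙    : Ty G
  _⇒_  : Ty G → Ty G → Ty G
  _⊠_  : Ty G → Ty G → Ty G
  𝕄    : Mon → Ty G → Ty G

infixr 5 _⇒_
infixr 6 _⊠_

data Tm (G Con : Set) : Set where
  var  : ℕ → Tm G Con
  con  : Con → Tm G Con
  ⋆    : Tm G Con
  lam  : Ty G → Tm G Con → Tm G Con              -- λ x^A . M   (binds index 0)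
  app  : Tm G Con → Tm G Con → Tm G Con
  pair : Tm G Con → Tm G Con → Tm G Con
  fst  : Tm G Con → Tm G Con
  snd  : Tm G Con → Tm G Con
  ret  : Mon → Tm G Con → Tm G Con
  iota : Tm G Con → Tm G Con
  bind : Mon → Tm G Con → Tm G Con → Tm G Con    -- do_X x ← M ; N  (N binds index 0)

ext : (ℕ → ℕ) → ℕ → ℕ
ext ρ zero    = zero
ext ρ (suc n) = suc (ρ n)

swap : ℕ → ℕ
swap zero          = suc zero
swap (suc zero)    = zero
swap (suc (suc n)) = suc (suc n)

module _ {G Con : Set} where

  ren : (ℕ → ℕ) → Tm G Con → Tm G Con
  ren ρ (var n)      = var (ρ n)
  ren ρ (con c)      = con c
  ren ρ ⋆            = ⋆
  ren ρ (lam A M)    = lam A (ren (ext ρ) M)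
  ren ρ (app M N)    = app (ren ρ M) (ren ρ N)
  ren ρ (pair M N)   = pair (ren ρ M) (ren ρ N)
  ren ρ (fst M)      = fst (ren ρ M)
  ren ρ (snd M)      = snd (ren ρ M)
  ren ρ (ret X M)    = ret X (ren ρ M)
  ren ρ (iota M)     = iota (ren ρ M)
  ren ρ (bind X M N) = bind X (ren ρ M) (ren (ext ρ) N)

  exts : (ℕ → Tm G Con) → ℕ → Tm G Con
  exts σ zero    = var zero
  exts σ (suc n) = ren suc (σ n)

  sub : (ℕ → Tm G Con) → Tm G Con → Tm G Con
  sub σ (var n)      = σ n
  sub σ (con c)      = con c
  sub σ ⋆            = ⋆
  sub σ (lam A M)    = lam A (sub (exts σ) M)
  sub σ (app M N)    = app (sub σ M) (sub σ N)
  sub σ (pair M N)   = pair (sub σ M) (sub σ N)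
  sub σ (fst M)      = fst (sub σ M)
  sub σ (snd M)      = snd (sub σ M)
  sub σ (ret X M)    = ret X (sub σ M)
  sub σ (iota M)     = iota (sub σ M)
  sub σ (bind X M N) = bind X (sub σ M) (sub (exts σ) N)

  -- substitution of N for index 0 (indices ≥ 1 are decremented)
  σ₀ : Tm G Con → ℕ → Tm G Con
  σ₀ N zero    = N
  σ₀ N (suc n) = var n

  _[_]₀ : Tm G Con → Tm G Con → Tm G Con
  M [ N ]₀ = sub (σ₀ N) M


record Signature : Set₁ where
  field
    G     : Set
    Con   : Set
    conTy : Con → Ty G
    TyAx  : Ty G → Ty G → Set

module Typing (Sig : Signature) where
  open Signature Sig public

  Type = Ty G
  Term = Tm G Con
  Ctx  = List Type

  infix 4 _≐_ _∋_∶_ _⊢_∶_ _⊢ˢ_∶_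

  data _≐_ : Type → Type → Set where
    ≐-refl  : ∀ {A} → A ≐ A
    ≐-sym   : ∀ {A B} → A ≐ B → B ≐ A
    ≐-trans : ∀ {A B C} → A ≐ B → B ≐ C → A ≐ C
    ≐-ax    : ∀ {A B} → TyAx A B → A ≐ B
    ≐-⇒     : ∀ {A A' B B'} → A ≐ A' → B ≐ B' → (A ⇒ B) ≐ (A' ⇒ B')
    ≐-⊠     : ∀ {A A' B B'} → A ≐ A' → B ≐ B' → (A ⊠ B) ≐ (A' ⊠ B')
    ≐-𝕄     : ∀ {X A B} → A ≐ B → 𝕄 X A ≐ 𝕄 X B

  data _∋_∶_ : Ctx → ℕ → Type → Set where
    here  : ∀ {Γ A} → (A ∷ Γ) ∋ zero ∶ A
    there : ∀ {Γ n A B} → Γ ∋ n ∶ A → (B ∷ Γ) ∋ suc n ∶ A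

  data _⊢_∶_ : Ctx → Term → Type → Set where
    ⊢var  : ∀ {Γ n A} → Γ ∋ n ∶ A → Γ ⊢ var n ∶ A
    ⊢con  : ∀ {Γ} (c : Con) → Γ ⊢ con c ∶ conTy c
    ⊢⋆    : ∀ {Γ} → Γ ⊢ ⋆ ∶ 𝟙
    ⊢lam  : ∀ {Γ A B M} → (A ∷ Γ) ⊢ M ∶ B → Γ ⊢ lam A M ∶ A ⇒ B
    ⊢app  : ∀ {Γ A B M N} → Γ ⊢ M ∶ A ⇒ B → Γ ⊢ N ∶ A → Γ ⊢ app M N ∶ B
    ⊢pair : ∀ {Γ A B M N} → Γ ⊢ M ∶ A → Γ ⊢ N ∶ B → Γ ⊢ pair M N ∶ A ⊠ B
    ⊢fst  : ∀ {Γ A B M} → Γ ⊢ M ∶ A ⊠ B → Γ ⊢ fst M ∶ A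
    ⊢snd  : ∀ {Γ A B M} → Γ ⊢ M ∶ A ⊠ B → Γ ⊢ snd M ∶ B
    ⊢ret  : ∀ {Γ X A M} → Γ ⊢ M ∶ A → Γ ⊢ ret X M ∶ 𝕄 X A
    ⊢iota : ∀ {Γ A M} → Γ ⊢ M ∶ 𝕄 𝒮 A → Γ ⊢ iota M ∶ 𝕄 𝒯 A
    ⊢bind : ∀ {Γ X A B M N} → Γ ⊢ M ∶ 𝕄 X A → (A ∷ Γ) ⊢ N ∶ 𝕄 X B
          → Γ ⊢ bind X M N ∶ 𝕄 X B
    ⊢conv : ∀ {Γ A B M} → A ≐ B → Γ ⊢ M ∶ A → Γ ⊢ M ∶ B

  _⊢ˢ_∶_ : Ctx → (ℕ → Term) → Ctx → Set
  Δ ⊢ˢ σ ∶ Γ = ∀ {n A} → Γ ∋ n ∶ A → Δ ⊢ σ n ∶ A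

  ext-∋ : ∀ {Γ Δ ρ B} → (∀ {n A} → Γ ∋ n ∶ A → Δ ∋ ρ n ∶ A)
        → ∀ {n A} → (B ∷ Γ) ∋ n ∶ A → (B ∷ Δ) ∋ ext ρ n ∶ A
  ext-∋ h here      = here
  ext-∋ h (there x) = there (h x)

  ren-⊢ : ∀ {Γ Δ ρ M A} → (∀ {n A} → Γ ∋ n ∶ A → Δ ∋ ρ n ∶ A)
        → Γ ⊢ M ∶ A → Δ ⊢ ren ρ M ∶ A
  ren-⊢ h (⊢var x)     = ⊢var (h x)
  ren-⊢ h (⊢con c)     = ⊢con c
  ren-⊢ h ⊢⋆           = ⊢⋆
  ren-⊢ h (⊢lam d)     = ⊢lam (ren-⊢ (ext-∋ h) d)
  ren-⊢ h (⊢app d e)   = ⊢app (ren-⊢ h d) (ren-⊢ h e)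
  ren-⊢ h (⊢pair d e)  = ⊢pair (ren-⊢ h d) (ren-⊢ h e)
  ren-⊢ h (⊢fst d)     = ⊢fst (ren-⊢ h d)
  ren-⊢ h (⊢snd d)     = ⊢snd (ren-⊢ h d)
  ren-⊢ h (⊢ret d)     = ⊢ret (ren-⊢ h d)
  ren-⊢ h (⊢iota d)    = ⊢iota (ren-⊢ h d)
  ren-⊢ h (⊢bind d e)  = ⊢bind (ren-⊢ h d) (ren-⊢ (ext-∋ h) e)
  ren-⊢ h (⊢conv p d)  = ⊢conv p (ren-⊢ h d)

  exts-⊢ : ∀ {Γ Δ σ B} → Δ ⊢ˢ σ ∶ Γ → (B ∷ Δ) ⊢ˢ exts σ ∶ (B ∷ Γ)
  exts-⊢ h here      = ⊢var here
  exts-⊢ h (there x) = ren-⊢ there (h x)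

  sub-⊢ : ∀ {Γ Δ σ M A} → Δ ⊢ˢ σ ∶ Γ → Γ ⊢ M ∶ A → Δ ⊢ sub σ M ∶ A
  sub-⊢ h (⊢var x)     = h x
  sub-⊢ h (⊢con c)     = ⊢con c
  sub-⊢ h ⊢⋆           = ⊢⋆
  sub-⊢ h (⊢lam d)     = ⊢lam (sub-⊢ (exts-⊢ h) d)
  sub-⊢ h (⊢app d e)   = ⊢app (sub-⊢ h d) (sub-⊢ h e)
  sub-⊢ h (⊢pair d e)  = ⊢pair (sub-⊢ h d) (sub-⊢ h e)
  sub-⊢ h (⊢fst d)     = ⊢fst (sub-⊢ h d)
  sub-⊢ h (⊢snd d)     = ⊢snd (sub-⊢ h d)
  sub-⊢ h (⊢ret d)     = ⊢ret (sub-⊢ h d)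
  sub-⊢ h (⊢iota d)    = ⊢iota (sub-⊢ h d)
  sub-⊢ h (⊢bind d e)  = ⊢bind (sub-⊢ h d) (sub-⊢ (exts-⊢ h) e)
  sub-⊢ h (⊢conv p d)  = ⊢conv p (sub-⊢ h d)

  single-⊢ : ∀ {Δ B C f g} → (B ∷ []) ⊢ g ∶ C → Δ ⊢ f ∶ B → Δ ⊢ g [ f ]₀ ∶ C
  single-⊢ {Δ} {B} {C} {f} dg df = sub-⊢ h dg
    where
      h : Δ ⊢ˢ σ₀ f ∶ (B ∷ [])
      h here       = df
      h (there ())

record Theory : Set₁ where
  field
    sig : Signature
  open Typing sig
  field
    TmAx   : Ctx → Term → Term → Type → Set
    tmAxWT : ∀ {Γ M N A} → TmAx Γ M N A → Γ ⊢ M ∶ A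
    tmAxWT' : ∀ {Γ M N A} → TmAx Γ M N A → Γ ⊢ N ∶ A

module Equality (Th : Theory) where
  open Theory Th
  open Typing sig public

  infix 4 _⊢_≡_∶_

  data _⊢_≡_∶_ : Ctx → Term → Term → Type → Set where
    ≡-refl  : ∀ {Γ M A} → Γ ⊢ M ∶ A → Γ ⊢ M ≡ M ∶ A
    ≡-sym   : ∀ {Γ M N A} → Γ ⊢ M ≡ N ∶ A → Γ ⊢ N ≡ M ∶ A
    ≡-trans : ∀ {Γ M N P A} → Γ ⊢ M ≡ N ∶ A → Γ ⊢ N ≡ P ∶ A → Γ ⊢ M ≡ P ∶ A
    ≡-conv  : ∀ {Γ M N A B} → A ≐ B → Γ ⊢ M ≡ N ∶ A → Γ ⊢ M ≡ N ∶ B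
    ≡-lam   : ∀ {Γ A B M M'} → (A ∷ Γ) ⊢ M ≡ M' ∶ B → Γ ⊢ lam A M ≡ lam A M' ∶ A ⇒ B
    ≡-app   : ∀ {Γ A B M M' N N'} → Γ ⊢ M ≡ M' ∶ A ⇒ B → Γ ⊢ N ≡ N' ∶ A
            → Γ ⊢ app M N ≡ app M' N' ∶ B
    ≡-pair  : ∀ {Γ A B M M' N N'} → Γ ⊢ M ≡ M' ∶ A → Γ ⊢ N ≡ N' ∶ B
            → Γ ⊢ pair M N ≡ pair M' N' ∶ A ⊠ B
    ≡-fst   : ∀ {Γ A B M M'} → Γ ⊢ M ≡ M' ∶ A ⊠ B → Γ ⊢ fst M ≡ fst M' ∶ A
    ≡-snd   : ∀ {Γ A B M M'} → Γ ⊢ M ≡ M' ∶ A ⊠ B → Γ ⊢ snd M ≡ snd M' ∶ B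
    ≡-ret   : ∀ {Γ X A M M'} → Γ ⊢ M ≡ M' ∶ A → Γ ⊢ ret X M ≡ ret X M' ∶ 𝕄 X A
    ≡-iota  : ∀ {Γ A M M'} → Γ ⊢ M ≡ M' ∶ 𝕄 𝒮 A → Γ ⊢ iota M ≡ iota M' ∶ 𝕄 𝒯 A
    ≡-bind  : ∀ {Γ X A B M M' N N'} → Γ ⊢ M ≡ M' ∶ 𝕄 X A → (A ∷ Γ) ⊢ N ≡ N' ∶ 𝕄 X B
            → Γ ⊢ bind X M N ≡ bind X M' N' ∶ 𝕄 X B
    ≡-sub   : ∀ {Γ Δ σ M N A} → Δ ⊢ˢ σ ∶ Γ → Γ ⊢ M ≡ N ∶ A
            → Δ ⊢ sub σ M ≡ sub σ N ∶ A
    ≡-𝟙η    : ∀ {Γ M} → Γ ⊢ M ∶ 𝟙 → Γ ⊢ M ≡ ⋆ ∶ 𝟙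
    ≡-fstβ  : ∀ {Γ A B M N} → Γ ⊢ M ∶ A → Γ ⊢ N ∶ B → Γ ⊢ fst (pair M N) ≡ M ∶ A
    ≡-sndβ  : ∀ {Γ A B M N} → Γ ⊢ M ∶ A → Γ ⊢ N ∶ B → Γ ⊢ snd (pair M N) ≡ N ∶ B
    ≡-⊠η    : ∀ {Γ A B M} → Γ ⊢ M ∶ A ⊠ B → Γ ⊢ pair (fst M) (snd M) ≡ M ∶ A ⊠ B
    ≡-⇒β    : ∀ {Γ A B M N} → (A ∷ Γ) ⊢ M ∶ B → Γ ⊢ N ∶ A
            → Γ ⊢ app (lam A M) N ≡ M [ N ]₀ ∶ B
    ≡-⇒η    : ∀ {Γ A B M} → Γ ⊢ M ∶ A ⇒ B
            → Γ ⊢ lam A (app (ren suc M) (var zero)) ≡ M ∶ A ⇒ B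
    ≡-retβ  : ∀ {Γ X A B M N} → Γ ⊢ M ∶ A → (A ∷ Γ) ⊢ N ∶ 𝕄 X B
            → Γ ⊢ bind X (ret X M) N ≡ N [ M ]₀ ∶ 𝕄 X B
    ≡-retη  : ∀ {Γ X A M} → Γ ⊢ M ∶ 𝕄 X A
            → Γ ⊢ bind X M (ret X (var zero)) ≡ M ∶ 𝕄 X A
    ≡-assoc : ∀ {Γ X A B C M N P} → Γ ⊢ M ∶ 𝕄 X A → (A ∷ Γ) ⊢ N ∶ 𝕄 X B
            → (B ∷ Γ) ⊢ P ∶ 𝕄 X C
            → Γ ⊢ bind X (bind X M N) P ≡ bind X M (bind X N (ren (ext suc) P)) ∶ 𝕄 X C
    -- centrality:  do_T x ← ιM; do_T y ← N; P  =  do_T y ← N; do_T x ← ιM; P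
    ≡-central : ∀ {Γ A B C M N P} → Γ ⊢ M ∶ 𝕄 𝒮 A → Γ ⊢ N ∶ 𝕄 𝒯 B
              → (B ∷ A ∷ Γ) ⊢ P ∶ 𝕄 𝒯 C
              → Γ ⊢ bind 𝒯 (iota M) (bind 𝒯 (ren suc N) P)
                  ≡ bind 𝒯 N (bind 𝒯 (iota (ren suc M)) (ren swap P)) ∶ 𝕄 𝒯 C
    ≡-iota-inj : ∀ {Γ A M N} → Γ ⊢ M ∶ 𝕄 𝒮 A → Γ ⊢ N ∶ 𝕄 𝒮 A
               → Γ ⊢ iota M ≡ iota N ∶ 𝕄 𝒯 A → Γ ⊢ M ≡ N ∶ 𝕄 𝒮 A
    ≡-iota-bind : ∀ {Γ A B M N} → Γ ⊢ M ∶ 𝕄 𝒮 A → (A ∷ Γ) ⊢ N ∶ 𝕄 𝒮 B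
                → Γ ⊢ bind 𝒯 (iota M) (iota N) ≡ iota (bind 𝒮 M N) ∶ 𝕄 𝒯 B
    ≡-iota-ret  : ∀ {Γ A M} → Γ ⊢ M ∶ A → Γ ⊢ iota (ret 𝒮 M) ≡ ret 𝒯 M ∶ 𝕄 𝒯 A
    ≡-ax    : ∀ {Γ M N A} → TmAx Γ M N A → Γ ⊢ M ≡ N ∶ A

-- Since the objects of S(𝕋) are types *modulo*
-- type equality, categories carry an equivalence relation _≈ₒ_ on
-- objects, together with canonical "identity" morphisms  coe p : A → B
-- for p : A ≈ₒ B  (an E-category / category with object equality).

record CatData : Set₁ where
  infix 4 _≈ₒ_ _≈_
  infixr 9 _∘_
  field
    Obj  : Set
    _≈ₒ_ : Obj → Obj → Set
    Hom  : Obj → Obj → Set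
    _≈_  : ∀ {A B} → Hom A B → Hom A B → Set
    id   : ∀ {A} → Hom A A
    _∘_  : ∀ {A B C} → Hom B C → Hom A B → Hom A C
    coe  : ∀ {A B} → A ≈ₒ B → Hom A B

record IsCategory (𝒞 : CatData) : Set where
  open CatData 𝒞
  field
    ≈ₒ-equiv : IsEquivalence _≈ₒ_
    ≈-equiv  : ∀ {A B} → IsEquivalence (_≈_ {A} {B})
    ∘-resp   : ∀ {A B C} {f f' : Hom B C} {g g' : Hom A B}
             → f ≈ f' → g ≈ g' → f ∘ g ≈ f' ∘ g'
    idˡ      : ∀ {A B} (f : Hom A B) → id ∘ f ≈ f
    idʳ      : ∀ {A B} (f : Hom A B) → f ∘ id ≈ f
    assoc    : ∀ {A B C D} (h : Hom C D) (g : Hom B C) (f : Hom A B)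
             → (h ∘ g) ∘ f ≈ h ∘ (g ∘ f)
    coe-id   : ∀ {A} (p : A ≈ₒ A) → coe p ≈ id
    coe-∘    : ∀ {A B C} (p : B ≈ₒ C) (q : A ≈ₒ B) (r : A ≈ₒ C) → coe p ∘ coe q ≈ coe r

record CCCData (𝒞 : CatData) : Set where
  open CatData 𝒞
  infixr 6 _⊗_
  infixr 5 _⇛_
  field
    ⊤ₒ    : Obj
    !     : ∀ {A} → Hom A ⊤ₒ
    _⊗_   : Obj → Obj → Obj
    π₁    : ∀ {A B} → Hom (A ⊗ B) A
    π₂    : ∀ {A B} → Hom (A ⊗ B) B
    ⟨_,_⟩ : ∀ {C A B} → Hom C A → Hom C B → Hom C (A ⊗ B)
    _⇛_   : Obj → Obj → Obj
    ev    : ∀ {A B} → Hom ((A ⇛ B) ⊗ A) B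
    curry : ∀ {C A B} → Hom (C ⊗ A) B → Hom C (A ⇛ B)

  _×₁_ : ∀ {A A' B B'} → Hom A A' → Hom B B' → Hom (A ⊗ B) (A' ⊗ B')
  f ×₁ g = ⟨ f ∘ π₁ , g ∘ π₂ ⟩

  swap⊗ : ∀ {A B} → Hom (A ⊗ B) (B ⊗ A)
  swap⊗ = ⟨ π₂ , π₁ ⟩

  assoc⊗ : ∀ {A B C} → Hom ((A ⊗ B) ⊗ C) (A ⊗ (B ⊗ C))
  assoc⊗ = ⟨ π₁ ∘ π₁ , ⟨ π₂ ∘ π₁ , π₂ ⟩ ⟩

record IsCCC (𝒞 : CatData) (P : CCCData 𝒞) : Set where
  open CatData 𝒞
  open CCCData P
  field
    !-unique : ∀ {A} (f : Hom A ⊤ₒ) → f ≈ !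
    π₁-β     : ∀ {C A B} (f : Hom C A) (g : Hom C B) → π₁ ∘ ⟨ f , g ⟩ ≈ f
    π₂-β     : ∀ {C A B} (f : Hom C A) (g : Hom C B) → π₂ ∘ ⟨ f , g ⟩ ≈ g
    ⟨⟩-η     : ∀ {C A B} (h : Hom C (A ⊗ B)) → ⟨ π₁ ∘ h , π₂ ∘ h ⟩ ≈ h
    ⟨⟩-resp  : ∀ {C A B} {f f' : Hom C A} {g g' : Hom C B}
             → f ≈ f' → g ≈ g' → ⟨ f , g ⟩ ≈ ⟨ f' , g' ⟩
    ev-β     : ∀ {C A B} (f : Hom (C ⊗ A) B) → ev ∘ (curry f ×₁ id) ≈ f
    curry-η  : ∀ {C A B} (g : Hom C (A ⇛ B)) → curry (ev ∘ (g ×₁ id)) ≈ g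
    curry-resp : ∀ {C A B} {f f' : Hom (C ⊗ A) B} → f ≈ f' → curry f ≈ curry f'
    ⊗-resp   : ∀ {A A' B B'} → A ≈ₒ A' → B ≈ₒ B' → (A ⊗ B) ≈ₒ (A' ⊗ B')
    coe-⊗    : ∀ {A A' B B'} (p : A ≈ₒ A') (q : B ≈ₒ B')
             → coe (⊗-resp p q) ≈ coe p ×₁ coe q
    ⇛-resp   : ∀ {A A' B B'} → A ≈ₒ A' → B ≈ₒ B' → (A ⇛ B) ≈ₒ (A' ⇛ B')
    coe-⇛    : ∀ {A A' B B'} (p : A ≈ₒ A') (p' : A' ≈ₒ A) (q : B ≈ₒ B')
             → coe (⇛-resp p q) ≈ curry (coe q ∘ (ev ∘ (id ×₁ coe p')))

record MonadData (𝒞 : CatData) (P : CCCData 𝒞) : Set where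
  open CatData 𝒞
  open CCCData P
  field
    F₀ : Obj → Obj
    F₁ : ∀ {A B} → Hom A B → Hom (F₀ A) (F₀ B)
    η  : ∀ {A} → Hom A (F₀ A)
    μ  : ∀ {A} → Hom (F₀ (F₀ A)) (F₀ A)
    τ  : ∀ {A B} → Hom (A ⊗ F₀ B) (F₀ (A ⊗ B))

  τ' : ∀ {A B} → Hom (F₀ A ⊗ B) (F₀ (A ⊗ B))
  τ' = F₁ swap⊗ ∘ (τ ∘ swap⊗)

record IsStrongMonad (𝒞 : CatData) (P : CCCData 𝒞) (𝕊 : MonadData 𝒞 P) : Set where
  open CatData 𝒞
  open CCCData P
  open MonadData 𝕊
  field
    F-id     : ∀ {A} → F₁ (id {A}) ≈ id
    F-∘      : ∀ {A B C} (g : Hom B C) (f : Hom A B) → F₁ (g ∘ f) ≈ F₁ g ∘ F₁ f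
    F-resp   : ∀ {A B} {f f' : Hom A B} → f ≈ f' → F₁ f ≈ F₁ f'
    F-resp-ₒ : ∀ {A B} → A ≈ₒ B → F₀ A ≈ₒ F₀ B
    F-coe    : ∀ {A B} (p : A ≈ₒ B) → F₁ (coe p) ≈ coe (F-resp-ₒ p)
    η-nat    : ∀ {A B} (f : Hom A B) → η ∘ f ≈ F₁ f ∘ η
    μ-nat    : ∀ {A B} (f : Hom A B) → μ ∘ F₁ (F₁ f) ≈ F₁ f ∘ μ
    τ-nat    : ∀ {A A' B B'} (f : Hom A A') (g : Hom B B')
             → τ ∘ (f ×₁ F₁ g) ≈ F₁ (f ×₁ g) ∘ τ
    μ-assoc  : ∀ {A} → μ {A} ∘ F₁ μ ≈ μ ∘ μ
    μ-idˡ    : ∀ {A} → μ {A} ∘ η ≈ id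
    μ-idʳ    : ∀ {A} → μ {A} ∘ F₁ η ≈ id
    τ-unit   : ∀ {A} → F₁ π₂ ∘ τ {⊤ₒ} {A} ≈ π₂
    τ-assoc  : ∀ {A B C} → F₁ assoc⊗ ∘ τ {A ⊗ B} {C} ≈ τ ∘ ((id ×₁ τ) ∘ assoc⊗)
    τ-η      : ∀ {A B} → τ {A} {B} ∘ (id ×₁ η) ≈ η
    τ-μ      : ∀ {A B} → τ {A} {B} ∘ (id ×₁ μ) ≈ μ ∘ (F₁ τ ∘ τ)

record CSCModelData : Set₁ where
  field
    cat : CatData
    ccc : CCCData cat
    𝕋   : MonadData cat ccc
    𝕊   : MonadData cat ccc
  open CatData cat
  field
    ι   : ∀ {A} → Hom (MonadData.F₀ 𝕊 A) (MonadData.F₀ 𝕋 A)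

  monad : Mon → MonadData cat ccc
  monad 𝒮 = 𝕊
  monad 𝒯 = 𝕋

record IsCSCModel (𝔐 : CSCModelData) : Set where
  open CSCModelData 𝔐
  open CatData cat
  open CCCData ccc
  module T = MonadData 𝕋
  module S = MonadData 𝕊
  field
    isCat : IsCategory cat
    isCCC : IsCCC cat ccc
    isT   : IsStrongMonad cat ccc 𝕋
    isS   : IsStrongMonad cat ccc 𝕊
    ι-nat  : ∀ {A B} (f : Hom A B) → ι ∘ S.F₁ f ≈ T.F₁ f ∘ ι
    ι-η    : ∀ {A} → ι {A} ∘ S.η ≈ T.η
    ι-μ    : ∀ {A} → ι {A} ∘ S.μ ≈ T.μ ∘ (T.F₁ ι ∘ ι)
    ι-τ    : ∀ {A B} → ι {A ⊗ B} ∘ S.τ ≈ T.τ ∘ (id ×₁ ι)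
    ι-mono : ∀ {C A} (f g : Hom C (S.F₀ A)) → ι ∘ f ≈ ι ∘ g → f ≈ g
    -- every (𝒮X, ι_X) is a central cone of 𝒯
    central : ∀ {X Y} → T.μ ∘ (T.F₁ T.τ' ∘ (T.τ ∘ (ι {X} ×₁ id {T.F₀ Y})))
                      ≈ T.μ ∘ (T.F₁ T.τ ∘ (T.τ' ∘ (ι {X} ×₁ id {T.F₀ Y})))

module Interpretation (Th : Theory) (𝔐 : CSCModelData) (isM : IsCSCModel 𝔐) where
  open Equality Th
  open CSCModelData 𝔐
  open CatData cat
  open CCCData ccc
  open IsCSCModel isM
  open IsEquivalence (IsCategory.≈ₒ-equiv isCat) renaming (refl to ≈ₒ-refl; sym to ≈ₒ-sym; trans to ≈ₒ-trans)

  ⟦_⟧ty : (G → Obj) → Type → Obj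
  ⟦ g ⟧ty (gnd a) = g a
  ⟦ g ⟧ty 𝟙       = ⊤ₒ
  ⟦ g ⟧ty (A ⇒ B) = ⟦ g ⟧ty A ⇛ ⟦ g ⟧ty B
  ⟦ g ⟧ty (A ⊠ B) = ⟦ g ⟧ty A ⊗ ⟦ g ⟧ty B
  ⟦ g ⟧ty (𝕄 X A) = MonadData.F₀ (monad X) (⟦ g ⟧ty A)

  record Interp : Set where
    field
      base : G → Obj
      cst  : (c : Con) → Hom ⊤ₒ (⟦ base ⟧ty (conTy c))
      tyAx : ∀ {A B} → TyAx A B → ⟦ base ⟧ty A ≈ₒ ⟦ base ⟧ty B

  module Sem (I : Interp) where
    open Interp I

    ⟦_⟧ : Type → Obj
    ⟦ A ⟧ = ⟦ base ⟧ty A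

    ⟦_⟧ᶜ : Ctx → Obj
    ⟦ [] ⟧ᶜ    = ⊤ₒ
    ⟦ A ∷ Γ ⟧ᶜ = ⟦ Γ ⟧ᶜ ⊗ ⟦ A ⟧

    isMon : (X : Mon) → IsStrongMonad cat ccc (monad X)
    isMon 𝒮 = isS
    isMon 𝒯 = isT

    ⟦_⟧≐ : ∀ {A B} → A ≐ B → ⟦ A ⟧ ≈ₒ ⟦ B ⟧
    ⟦ ≐-refl ⟧≐      = ≈ₒ-refl
    ⟦ ≐-sym p ⟧≐     = ≈ₒ-sym ⟦ p ⟧≐
    ⟦ ≐-trans p q ⟧≐ = ≈ₒ-trans ⟦ p ⟧≐ ⟦ q ⟧≐
    ⟦ ≐-ax a ⟧≐      = tyAx a
    ⟦ ≐-⇒ p q ⟧≐     = IsCCC.⇛-resp isCCC ⟦ p ⟧≐ ⟦ q ⟧≐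
    ⟦ ≐-⊠ p q ⟧≐     = IsCCC.⊗-resp isCCC ⟦ p ⟧≐ ⟦ q ⟧≐
    ⟦ ≐-𝕄 {X} p ⟧≐   = IsStrongMonad.F-resp-ₒ (isMon X) ⟦ p ⟧≐

    ⟦_⟧ᵛ : ∀ {Γ n A} → Γ ∋ n ∶ A → Hom ⟦ Γ ⟧ᶜ ⟦ A ⟧
    ⟦ here ⟧ᵛ    = π₂
    ⟦ there x ⟧ᵛ = ⟦ x ⟧ᵛ ∘ π₁

    ⟦_⟧ᵗ : ∀ {Γ M A} → Γ ⊢ M ∶ A → Hom ⟦ Γ ⟧ᶜ ⟦ A ⟧
    ⟦ ⊢var x ⟧ᵗ    = ⟦ x ⟧ᵛ
    ⟦ ⊢con c ⟧ᵗ    = cst c ∘ !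
    ⟦ ⊢⋆ ⟧ᵗ        = !
    ⟦ ⊢lam d ⟧ᵗ    = curry ⟦ d ⟧ᵗ
    ⟦ ⊢app d e ⟧ᵗ  = ev ∘ ⟨ ⟦ d ⟧ᵗ , ⟦ e ⟧ᵗ ⟩
    ⟦ ⊢pair d e ⟧ᵗ = ⟨ ⟦ d ⟧ᵗ , ⟦ e ⟧ᵗ ⟩
    ⟦ ⊢fst d ⟧ᵗ    = π₁ ∘ ⟦ d ⟧ᵗ
    ⟦ ⊢snd d ⟧ᵗ    = π₂ ∘ ⟦ d ⟧ᵗ
    ⟦ ⊢ret {X = X} d ⟧ᵗ = MonadData.η (monad X) ∘ ⟦ d ⟧ᵗ
    ⟦ ⊢iota d ⟧ᵗ   = ι ∘ ⟦ d ⟧ᵗ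
    ⟦ ⊢bind {X = X} d e ⟧ᵗ =
      MonadData.μ (monad X) ∘ (MonadData.F₁ (monad X) ⟦ e ⟧ᵗ
        ∘ (MonadData.τ (monad X) ∘ ⟨ id , ⟦ d ⟧ᵗ ⟩))
    ⟦ ⊢conv p d ⟧ᵗ = coe ⟦ p ⟧≐ ∘ ⟦ d ⟧ᵗ

module Syntactic (Th : Theory) where
  open Equality Th

  SHom : Type → Type → Set
  SHom A B = Σ Term (λ f → (A ∷ []) ⊢ f ∶ B)

  SynCat : CatData
  SynCat = record
    { Obj  = Type
    ; _≈ₒ_ = _≐_
    ; Hom  = SHom
    ; _≈_  = λ {A} {B} f g → (A ∷ []) ⊢ proj₁ f ≡ proj₁ g ∶ B
    ; id   = var zero , ⊢var here
    ; _∘_  = λ g f → (proj₁ g [ proj₁ f ]₀) , single-⊢ (proj₂ g) (proj₂ f)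
    ; coe  = λ p → var zero , ⊢conv p (⊢var here)
    }

  private
    h-curry : ∀ {C A} → (A ∷ C ∷ []) ⊢ˢ (σ₀ (pair (var (suc zero)) (var zero))) ∶ ((C ⊠ A) ∷ [])
    h-curry here = ⊢pair (⊢var (there here)) (⊢var here)
    h-curry (there ())

  SynCCC : CCCData SynCat
  SynCCC = record
    { ⊤ₒ    = 𝟙
    ; !     = ⋆ , ⊢⋆
    ; _⊗_   = _⊠_
    ; π₁    = fst (var zero) , ⊢fst (⊢var here)
    ; π₂    = snd (var zero) , ⊢snd (⊢var here)
    ; ⟨_,_⟩ = λ f g → pair (proj₁ f) (proj₁ g) , ⊢pair (proj₂ f) (proj₂ g)
    ; _⇛_   = _⇒_
    ; ev    = app (fst (var zero)) (snd (var zero)) , ⊢app (⊢fst (⊢var here)) (⊢snd (⊢var here))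
    ; curry = λ {C} {A} f → lam A (sub (σ₀ (pair (var (suc zero)) (var zero))) (proj₁ f))
                          , ⊢lam (sub-⊢ h-curry (proj₂ f))
    }

  SynMonad : Mon → MonadData SynCat SynCCC
  SynMonad X = record
    { F₀ = 𝕄 X
    ; F₁ = λ f → bind X (var zero) (ret X (proj₁ f [ var zero ]₀))
               , ⊢bind (⊢var here) (⊢ret (single-⊢ (proj₂ f) (⊢var here)))
    ; η  = ret X (var zero) , ⊢ret (⊢var here)
    ; μ  = bind X (var zero) (var zero) , ⊢bind (⊢var here) (⊢var here)
    ; τ  = bind X (snd (var zero)) (ret X (pair (fst (var (suc zero))) (var zero)))
         , ⊢bind (⊢snd (⊢var here)) (⊢ret (⊢pair (⊢fst (⊢var (there here))) (⊢var here)))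
    }

  Syn : CSCModelData
  Syn = record
    { cat = SynCat
    ; ccc = SynCCC
    ; 𝕋   = SynMonad 𝒯
    ; 𝕊   = SynMonad 𝒮
    ; ι   = iota (var zero) , ⊢iota (⊢var here)
    }

  module _ (isM : IsCSCModel Syn) where
    open Interpretation Th Syn isM

    ⟦gnd⟧ : ∀ A → ⟦ gnd ⟧ty A PE.≡ A
    ⟦gnd⟧ (gnd a)   = PE.refl
    ⟦gnd⟧ 𝟙         = PE.refl
    ⟦gnd⟧ (A ⇒ B)   = PE.cong₂ _⇒_ (⟦gnd⟧ A) (⟦gnd⟧ B)
    ⟦gnd⟧ (A ⊠ B)   = PE.cong₂ _⊠_ (⟦gnd⟧ A) (⟦gnd⟧ B)
    ⟦gnd⟧ (𝕄 𝒮 A)   = PE.cong (𝕄 𝒮) (⟦gnd⟧ A)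
    ⟦gnd⟧ (𝕄 𝒯 A)   = PE.cong (𝕄 𝒯) (⟦gnd⟧ A)

    canonical : Interp
    canonical = record
      { base = gnd
      ; cst  = λ c → PE.subst (SHom 𝟙) (PE.sym (⟦gnd⟧ (conTy c))) (con c , ⊢con c)
      ; tyAx = λ {A} {B} a → PE.subst₂ _≐_ (PE.sym (⟦gnd⟧ A)) (PE.sym (⟦gnd⟧ B)) (≐-ax a)
      }

-- Every law of a CSC-model, read on morphisms x : A ⊢ f : B of S(𝕋), is one of the equations of
-- CSC: the cartesian closed laws are the βη-laws for 1, ×, →, the monad and strength laws are the
-- monad laws of do-notation, the laws of ι are the three ι-axioms, and the centrality of (𝒮X, ι)
-- is the centrality axiom itself.  For soundness and completeness, the interpretation of Γ ⊢ M : A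
-- is provably equal to M with its variables read off the single variable x : ⟦ Γ ⟧ by projections;
-- substituting back the tuple of the variables of Γ recovers M, so the two equalities coincide.
-- For types, ⟦ A ⟧ is A itself.

module Submission where

open import Defs
open import Data.Nat using (ℕ; zero; suc)
open import Data.List using ([]; _∷_)
open import Data.Product using (Σ; _×_; _,_; proj₁; proj₂)
open import Function.Base using (_∘′_)
open import Function.Bundles using (_⇔_; mk⇔)
import Relation.Binary.PropositionalEquality as PE
import Relation.Binary.Reasoning.Base.Partial as Partial
open PE using (refl; cong; cong₂; module ≡-Reasoning) renaming (_≡_ to _≣_)

module SubstitutionLemmas {G Con : Set} where

  private
    Term : Set
    Term = Tm G Con

  exts-cong : ∀ {σ σ' : ℕ → Term} → (∀ n → σ n ≣ σ' n) → ∀ n → exts σ n ≣ exts σ' n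
  exts-cong h zero    = refl
  exts-cong h (suc n) = cong (ren suc) (h n)

  sub-cong : ∀ {σ σ' : ℕ → Term} → (∀ n → σ n ≣ σ' n) → ∀ M → sub σ M ≣ sub σ' M
  sub-cong h (var n)      = h n
  sub-cong h (con c)      = refl
  sub-cong h ⋆            = refl
  sub-cong h (lam A M)    = cong (lam A) (sub-cong (exts-cong h) M)
  sub-cong h (app M N)    = cong₂ app (sub-cong h M) (sub-cong h N)
  sub-cong h (pair M N)   = cong₂ pair (sub-cong h M) (sub-cong h N)
  sub-cong h (fst M)      = cong fst (sub-cong h M)
  sub-cong h (snd M)      = cong snd (sub-cong h M)
  sub-cong h (ret X M)    = cong (ret X) (sub-cong h M)
  sub-cong h (iota M)     = cong iota (sub-cong h M)
  sub-cong h (bind X M N) = cong₂ (bind X) (sub-cong h M) (sub-cong (exts-cong h) N)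

  exts-var : ∀ ρ n → exts (var ∘′ ρ) n ≣ var {G} {Con} (ext ρ n)
  exts-var ρ zero    = refl
  exts-var ρ (suc n) = refl

  sub-var : ∀ ρ M → sub (var ∘′ ρ) M ≣ ren ρ M
  sub-var ρ (var n)      = refl
  sub-var ρ (con c)      = refl
  sub-var ρ ⋆            = refl
  sub-var ρ (lam A M)    = cong (lam A) (PE.trans (sub-cong (exts-var ρ) M) (sub-var (ext ρ) M))
  sub-var ρ (app M N)    = cong₂ app (sub-var ρ M) (sub-var ρ N)
  sub-var ρ (pair M N)   = cong₂ pair (sub-var ρ M) (sub-var ρ N)
  sub-var ρ (fst M)      = cong fst (sub-var ρ M)
  sub-var ρ (snd M)      = cong snd (sub-var ρ M)
  sub-var ρ (ret X M)    = cong (ret X) (sub-var ρ M)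
  sub-var ρ (iota M)     = cong iota (sub-var ρ M)
  sub-var ρ (bind X M N) = cong₂ (bind X) (sub-var ρ M) (PE.trans (sub-cong (exts-var ρ) N) (sub-var (ext ρ) N))

  exts-id : ∀ n → exts var n ≣ var {G} {Con} n
  exts-id zero    = refl
  exts-id (suc n) = refl

  sub-id : ∀ (M : Term) → sub var M ≣ M
  sub-id (var n)      = refl
  sub-id (con c)      = refl
  sub-id ⋆            = refl
  sub-id (lam A M)    = cong (lam A) (PE.trans (sub-cong exts-id M) (sub-id M))
  sub-id (app M N)    = cong₂ app (sub-id M) (sub-id N)
  sub-id (pair M N)   = cong₂ pair (sub-id M) (sub-id N)
  sub-id (fst M)      = cong fst (sub-id M)
  sub-id (snd M)      = cong snd (sub-id M)
  sub-id (ret X M)    = cong (ret X) (sub-id M)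
  sub-id (iota M)     = cong iota (sub-id M)
  sub-id (bind X M N) = cong₂ (bind X) (sub-id M) (PE.trans (sub-cong exts-id N) (sub-id N))

  exts-ext : ∀ (σ : ℕ → Term) ρ n → exts σ (ext ρ n) ≣ exts (σ ∘′ ρ) n
  exts-ext σ ρ zero    = refl
  exts-ext σ ρ (suc n) = refl

  sub-ren : ∀ (σ : ℕ → Term) ρ M → sub σ (ren ρ M) ≣ sub (σ ∘′ ρ) M
  sub-ren σ ρ (var n)      = refl
  sub-ren σ ρ (con c)      = refl
  sub-ren σ ρ ⋆            = refl
  sub-ren σ ρ (lam A M)    = cong (lam A) (PE.trans (sub-ren (exts σ) (ext ρ) M) (sub-cong (exts-ext σ ρ) M))
  sub-ren σ ρ (app M N)    = cong₂ app (sub-ren σ ρ M) (sub-ren σ ρ N)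
  sub-ren σ ρ (pair M N)   = cong₂ pair (sub-ren σ ρ M) (sub-ren σ ρ N)
  sub-ren σ ρ (fst M)      = cong fst (sub-ren σ ρ M)
  sub-ren σ ρ (snd M)      = cong snd (sub-ren σ ρ M)
  sub-ren σ ρ (ret X M)    = cong (ret X) (sub-ren σ ρ M)
  sub-ren σ ρ (iota M)     = cong iota (sub-ren σ ρ M)
  sub-ren σ ρ (bind X M N) = cong₂ (bind X) (sub-ren σ ρ M) (PE.trans (sub-ren (exts σ) (ext ρ) N) (sub-cong (exts-ext σ ρ) N))

  ren-ren : ∀ ρ ρ' (M : Term) → ren ρ (ren ρ' M) ≣ ren (ρ ∘′ ρ') M
  ren-ren ρ ρ' M = begin
    ren ρ (ren ρ' M)              ≡⟨ PE.sym (sub-var ρ (ren ρ' M)) ⟩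
    sub (var ∘′ ρ) (ren ρ' M)     ≡⟨ sub-ren (var ∘′ ρ) ρ' M ⟩
    sub (var ∘′ ρ ∘′ ρ') M        ≡⟨ sub-var (ρ ∘′ ρ') M ⟩
    ren (ρ ∘′ ρ') M               ∎
    where open ≡-Reasoning

  ren-exts : ∀ ρ (σ : ℕ → Term) n → ren (ext ρ) (exts σ n) ≣ exts (ren ρ ∘′ σ) n
  ren-exts ρ σ zero    = refl
  ren-exts ρ σ (suc n) = PE.trans (ren-ren (ext ρ) suc (σ n)) (PE.sym (ren-ren suc ρ (σ n)))

  ren-sub : ∀ ρ (σ : ℕ → Term) M → ren ρ (sub σ M) ≣ sub (ren ρ ∘′ σ) M
  ren-sub ρ σ (var n)      = refl
  ren-sub ρ σ (con c)      = refl
  ren-sub ρ σ ⋆            = refl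
  ren-sub ρ σ (lam A M)    = cong (lam A) (PE.trans (ren-sub (ext ρ) (exts σ) M) (sub-cong (ren-exts ρ σ) M))
  ren-sub ρ σ (app M N)    = cong₂ app (ren-sub ρ σ M) (ren-sub ρ σ N)
  ren-sub ρ σ (pair M N)   = cong₂ pair (ren-sub ρ σ M) (ren-sub ρ σ N)
  ren-sub ρ σ (fst M)      = cong fst (ren-sub ρ σ M)
  ren-sub ρ σ (snd M)      = cong snd (ren-sub ρ σ M)
  ren-sub ρ σ (ret X M)    = cong (ret X) (ren-sub ρ σ M)
  ren-sub ρ σ (iota M)     = cong iota (ren-sub ρ σ M)
  ren-sub ρ σ (bind X M N) = cong₂ (bind X) (ren-sub ρ σ M) (PE.trans (ren-sub (ext ρ) (exts σ) N) (sub-cong (ren-exts ρ σ) N))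

  sub-exts : ∀ (τ σ : ℕ → Term) n → sub (exts τ) (exts σ n) ≣ exts (sub τ ∘′ σ) n
  sub-exts τ σ zero    = refl
  sub-exts τ σ (suc n) = PE.trans (sub-ren (exts τ) suc (σ n)) (PE.sym (ren-sub suc τ (σ n)))

  sub-sub : ∀ (τ σ : ℕ → Term) M → sub τ (sub σ M) ≣ sub (sub τ ∘′ σ) M
  sub-sub τ σ (var n)      = refl
  sub-sub τ σ (con c)      = refl
  sub-sub τ σ ⋆            = refl
  sub-sub τ σ (lam A M)    = cong (lam A) (PE.trans (sub-sub (exts τ) (exts σ) M) (sub-cong (sub-exts τ σ) M))
  sub-sub τ σ (app M N)    = cong₂ app (sub-sub τ σ M) (sub-sub τ σ N)
  sub-sub τ σ (pair M N)   = cong₂ pair (sub-sub τ σ M) (sub-sub τ σ N)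
  sub-sub τ σ (fst M)      = cong fst (sub-sub τ σ M)
  sub-sub τ σ (snd M)      = cong snd (sub-sub τ σ M)
  sub-sub τ σ (ret X M)    = cong (ret X) (sub-sub τ σ M)
  sub-sub τ σ (iota M)     = cong iota (sub-sub τ σ M)
  sub-sub τ σ (bind X M N) = cong₂ (bind X) (sub-sub τ σ M) (PE.trans (sub-sub (exts τ) (exts σ) N) (sub-cong (sub-exts τ σ) N))

module TypedSubstitution (Th : Theory) where
  open Equality Th
  open SubstitutionLemmas

  infixr 2 _⟫_ _⟫≣_ _≣⟫_

  _⟫_ : ∀ {Γ M N P A} → Γ ⊢ M ≡ N ∶ A → Γ ⊢ N ≡ P ∶ A → Γ ⊢ M ≡ P ∶ A
  _⟫_ = ≡-trans

  _⟫≣_ : ∀ {Γ M N P A} → Γ ⊢ M ≡ N ∶ A → N ≣ P → Γ ⊢ M ≡ P ∶ A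
  p ⟫≣ refl = p

  _≣⟫_ : ∀ {Γ M N P A} → M ≣ N → Γ ⊢ N ≡ P ∶ A → Γ ⊢ M ≡ P ∶ A
  refl ≣⟫ p = p

  wk-⊢ : ∀ {Δ B M A} → Δ ⊢ M ∶ A → (B ∷ Δ) ⊢ ren suc M ∶ A
  wk-⊢ = ren-⊢ there

  wk-⊢ˢ : ∀ {Δ B} → (B ∷ Δ) ⊢ˢ var ∘′ suc ∶ Δ
  wk-⊢ˢ x = ⊢var (there x)

  σ₀-⊢ˢ : ∀ {Γ A N} → Γ ⊢ N ∶ A → Γ ⊢ˢ σ₀ N ∶ (A ∷ Γ)
  σ₀-⊢ˢ d here      = d
  σ₀-⊢ˢ d (there x) = ⊢var x

  single-⊢ˢ : ∀ {Δ B N} → Δ ⊢ N ∶ B → Δ ⊢ˢ σ₀ N ∶ (B ∷ [])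
  single-⊢ˢ d here = d

  []₀-⊢ : ∀ {Γ A B M N} → (A ∷ Γ) ⊢ M ∶ B → Γ ⊢ N ∶ A → Γ ⊢ M [ N ]₀ ∶ B
  []₀-⊢ dM dN = sub-⊢ (σ₀-⊢ˢ dN) dM

  swap-∋ : ∀ {Γ A B n C} → (B ∷ A ∷ Γ) ∋ n ∶ C → (A ∷ B ∷ Γ) ∋ swap n ∶ C
  swap-∋ here              = there here
  swap-∋ (there here)      = here
  swap-∋ (there (there x)) = there (there x)

  wk-≡ : ∀ {Δ B M N A} → Δ ⊢ M ≡ N ∶ A → (B ∷ Δ) ⊢ ren suc M ≡ ren suc N ∶ A
  wk-≡ {M = M} {N} p = PE.sym (sub-var suc M) ≣⟫ ≡-sub wk-⊢ˢ p ⟫≣ sub-var suc N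

  ≡-regular : ∀ {Γ M N A} → Γ ⊢ M ≡ N ∶ A → (Γ ⊢ M ∶ A) × (Γ ⊢ N ∶ A)
  ≡-regular (≡-refl d)          = d , d
  ≡-regular (≡-sym p)           = proj₂ (≡-regular p) , proj₁ (≡-regular p)
  ≡-regular (≡-trans p q)       = proj₁ (≡-regular p) , proj₂ (≡-regular q)
  ≡-regular (≡-conv e p)        = ⊢conv e (proj₁ (≡-regular p)) , ⊢conv e (proj₂ (≡-regular p))
  ≡-regular (≡-lam p)           = ⊢lam (proj₁ (≡-regular p)) , ⊢lam (proj₂ (≡-regular p))
  ≡-regular (≡-app p q)         = ⊢app (proj₁ (≡-regular p)) (proj₁ (≡-regular q))
                                , ⊢app (proj₂ (≡-regular p)) (proj₂ (≡-regular q))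
  ≡-regular (≡-pair p q)        = ⊢pair (proj₁ (≡-regular p)) (proj₁ (≡-regular q))
                                , ⊢pair (proj₂ (≡-regular p)) (proj₂ (≡-regular q))
  ≡-regular (≡-fst p)           = ⊢fst (proj₁ (≡-regular p)) , ⊢fst (proj₂ (≡-regular p))
  ≡-regular (≡-snd p)           = ⊢snd (proj₁ (≡-regular p)) , ⊢snd (proj₂ (≡-regular p))
  ≡-regular (≡-ret p)           = ⊢ret (proj₁ (≡-regular p)) , ⊢ret (proj₂ (≡-regular p))
  ≡-regular (≡-iota p)          = ⊢iota (proj₁ (≡-regular p)) , ⊢iota (proj₂ (≡-regular p))
  ≡-regular (≡-bind p q)        = ⊢bind (proj₁ (≡-regular p)) (proj₁ (≡-regular q))
                                , ⊢bind (proj₂ (≡-regular p)) (proj₂ (≡-regular q))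
  ≡-regular (≡-sub h p)         = sub-⊢ h (proj₁ (≡-regular p)) , sub-⊢ h (proj₂ (≡-regular p))
  ≡-regular (≡-𝟙η d)            = d , ⊢⋆
  ≡-regular (≡-fstβ d e)        = ⊢fst (⊢pair d e) , d
  ≡-regular (≡-sndβ d e)        = ⊢snd (⊢pair d e) , e
  ≡-regular (≡-⊠η d)            = ⊢pair (⊢fst d) (⊢snd d) , d
  ≡-regular (≡-⇒β d e)          = ⊢app (⊢lam d) e , []₀-⊢ d e
  ≡-regular (≡-⇒η d)            = ⊢lam (⊢app (wk-⊢ d) (⊢var here)) , d
  ≡-regular (≡-retβ d e)        = ⊢bind (⊢ret d) e , []₀-⊢ e d
  ≡-regular (≡-retη d)          = ⊢bind d (⊢ret (⊢var here)) , d
  ≡-regular (≡-assoc d e f)     = ⊢bind (⊢bind d e) f , ⊢bind d (⊢bind e (ren-⊢ (ext-∋ there) f))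
  ≡-regular (≡-central d e f)   = ⊢bind (⊢iota d) (⊢bind (wk-⊢ e) f)
                                , ⊢bind e (⊢bind (⊢iota (wk-⊢ d)) (ren-⊢ swap-∋ f))
  ≡-regular (≡-iota-inj d e p)  = d , e
  ≡-regular (≡-iota-bind d e)   = ⊢bind (⊢iota d) (⊢iota e) , ⊢iota (⊢bind d e)
  ≡-regular (≡-iota-ret d)      = ⊢iota (⊢ret d) , ⊢ret d
  ≡-regular (≡-ax a)            = Theory.tmAxWT Th a , Theory.tmAxWT' Th a

  infix 4 _⊢ˢ_≡_∶_
  _⊢ˢ_≡_∶_ : Ctx → (ℕ → Term) → (ℕ → Term) → Ctx → Set
  Δ ⊢ˢ σ ≡ σ' ∶ Γ = ∀ {n A} → Γ ∋ n ∶ A → Δ ⊢ σ n ≡ σ' n ∶ A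

  exts-≡ˢ : ∀ {Γ Δ σ σ' B} → Δ ⊢ˢ σ ≡ σ' ∶ Γ → (B ∷ Δ) ⊢ˢ exts σ ≡ exts σ' ∶ (B ∷ Γ)
  exts-≡ˢ h here      = ≡-refl (⊢var here)
  exts-≡ˢ h (there x) = wk-≡ (h x)

  sub-≡ˢ : ∀ {Γ Δ σ σ' M A} → Γ ⊢ M ∶ A → Δ ⊢ˢ σ ≡ σ' ∶ Γ → Δ ⊢ sub σ M ≡ sub σ' M ∶ A
  sub-≡ˢ (⊢var x)    h = h x
  sub-≡ˢ (⊢con c)    h = ≡-refl (⊢con c)
  sub-≡ˢ ⊢⋆          h = ≡-refl ⊢⋆
  sub-≡ˢ (⊢lam d)    h = ≡-lam (sub-≡ˢ d (exts-≡ˢ h))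
  sub-≡ˢ (⊢app d e)  h = ≡-app (sub-≡ˢ d h) (sub-≡ˢ e h)
  sub-≡ˢ (⊢pair d e) h = ≡-pair (sub-≡ˢ d h) (sub-≡ˢ e h)
  sub-≡ˢ (⊢fst d)    h = ≡-fst (sub-≡ˢ d h)
  sub-≡ˢ (⊢snd d)    h = ≡-snd (sub-≡ˢ d h)
  sub-≡ˢ (⊢ret d)    h = ≡-ret (sub-≡ˢ d h)
  sub-≡ˢ (⊢iota d)   h = ≡-iota (sub-≡ˢ d h)
  sub-≡ˢ (⊢bind d e) h = ≡-bind (sub-≡ˢ d h) (sub-≡ˢ e (exts-≡ˢ h))
  sub-≡ˢ (⊢conv p d) h = ≡-conv p (sub-≡ˢ d h)

  AgreeOn : Ctx → (ℕ → Term) → (ℕ → Term) → Set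
  AgreeOn Γ σ σ' = ∀ {n A} → Γ ∋ n ∶ A → σ n ≣ σ' n

  exts-agree : ∀ {Γ σ σ' B} → AgreeOn Γ σ σ' → AgreeOn (B ∷ Γ) (exts σ) (exts σ')
  exts-agree h here      = refl
  exts-agree h (there x) = cong (ren suc) (h x)

  sub-cong-⊢ : ∀ {Γ σ σ' M A} → Γ ⊢ M ∶ A → AgreeOn Γ σ σ' → sub σ M ≣ sub σ' M
  sub-cong-⊢ (⊢var x)    h = h x
  sub-cong-⊢ (⊢con c)    h = refl
  sub-cong-⊢ ⊢⋆          h = refl
  sub-cong-⊢ (⊢lam d)    h = cong (lam _) (sub-cong-⊢ d (exts-agree h))
  sub-cong-⊢ (⊢app d e)  h = cong₂ app (sub-cong-⊢ d h) (sub-cong-⊢ e h)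
  sub-cong-⊢ (⊢pair d e) h = cong₂ pair (sub-cong-⊢ d h) (sub-cong-⊢ e h)
  sub-cong-⊢ (⊢fst d)    h = cong fst (sub-cong-⊢ d h)
  sub-cong-⊢ (⊢snd d)    h = cong snd (sub-cong-⊢ d h)
  sub-cong-⊢ (⊢ret d)    h = cong (ret _) (sub-cong-⊢ d h)
  sub-cong-⊢ (⊢iota d)   h = cong iota (sub-cong-⊢ d h)
  sub-cong-⊢ (⊢bind d e) h = cong₂ (bind _) (sub-cong-⊢ d h) (sub-cong-⊢ e (exts-agree h))
  sub-cong-⊢ (⊢conv p d) h = sub-cong-⊢ d h

  -- A term of a one-variable context only sees the image of var zero, so any composite
  -- substitution applied to it is a single _[_]₀.
  sub-cong-⊢₁ : ∀ {A B σ σ' f} → (A ∷ []) ⊢ f ∶ B → σ zero ≣ σ' zero → sub σ f ≣ sub σ' f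
  sub-cong-⊢₁ d e = sub-cong-⊢ d λ { here → e }

  []₀-≡ : ∀ {A B Δ t t' f} → (A ∷ []) ⊢ f ∶ B → Δ ⊢ t ≡ t' ∶ A → Δ ⊢ f [ t ]₀ ≡ f [ t' ]₀ ∶ B
  []₀-≡ d e = sub-≡ˢ d λ { here → e }

  sub-var₁ : ∀ {A B σ f} → (A ∷ []) ⊢ f ∶ B → σ zero ≣ var zero → sub σ f ≣ f
  sub-var₁ {f = f} d e = PE.trans (sub-cong-⊢₁ d e) (sub-id f)

  sub-sub₁ : ∀ {A B f} (τ σ : ℕ → Term) → (A ∷ []) ⊢ f ∶ B → sub τ (sub σ f) ≣ f [ sub τ (σ zero) ]₀
  sub-sub₁ {f = f} τ σ d = PE.trans (sub-sub τ σ f) (sub-cong-⊢₁ d refl)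

  sub-sub-sub₁ : ∀ {A B f} (a b c : ℕ → Term) → (A ∷ []) ⊢ f ∶ B
               → sub a (sub b (sub c f)) ≣ f [ sub a (sub b (c zero)) ]₀
  sub-sub-sub₁ a b c d = PE.trans (cong (sub a) (sub-sub₁ b c d)) (sub-sub₁ a (σ₀ _) d)

  ren₁ : ∀ {A B f} ρ → (A ∷ []) ⊢ f ∶ B → ren ρ f ≣ f [ var (ρ zero) ]₀
  ren₁ {f = f} ρ d = PE.trans (PE.sym (sub-var ρ f)) (sub-cong-⊢₁ d refl)

  sub-ren₁ : ∀ {A B f} (σ : ℕ → Term) ρ → (A ∷ []) ⊢ f ∶ B → sub σ (ren ρ f) ≣ f [ σ (ρ zero) ]₀
  sub-ren₁ {f = f} σ ρ d = PE.trans (sub-ren σ ρ f) (sub-cong-⊢₁ d refl)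

  ren-sub₁ : ∀ {A B f} ρ (σ : ℕ → Term) → (A ∷ []) ⊢ f ∶ B → ren ρ (sub σ f) ≣ f [ ren ρ (σ zero) ]₀
  ren-sub₁ {f = f} ρ σ d = PE.trans (ren-sub ρ σ f) (sub-cong-⊢₁ d refl)

  sub-ren-sub₁ : ∀ {A B f} (τ : ℕ → Term) ρ σ → (A ∷ []) ⊢ f ∶ B
               → sub τ (ren ρ (sub σ f)) ≣ f [ sub τ (ren ρ (σ zero)) ]₀
  sub-ren-sub₁ τ ρ σ d = PE.trans (cong (sub τ) (ren-sub₁ ρ σ d)) (sub-sub₁ τ (σ₀ _) d)

  ⊢₁-weaken : ∀ {Γ A B f} → (A ∷ []) ⊢ f ∶ B → (A ∷ Γ) ⊢ f ∶ B
  ⊢₁-weaken {f = f} d = PE.subst (λ g → _ ⊢ g ∶ _) (sub-id f) (sub-⊢ (λ { here → ⊢var here }) d)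

  -- Provable equality is reflexive only on well-typed terms.
  module ⊢≡-Reasoning {Γ A} = Partial (λ M N → Γ ⊢ M ≡ N ∶ A) ≡-trans

module SyntacticModel (Th : Theory) where
  open Equality Th
  open SubstitutionLemmas
  open TypedSubstitution Th
  open Syntactic Th
  open CatData SynCat using (Hom) renaming (_∘_ to _∘ₛ_; id to idₛ)
  open CCCData SynCCC

  v₀ v₁ v₂ : Term
  v₀ = var zero
  v₁ = var (suc zero)
  v₂ = var (suc (suc zero))

  ⊢v₀ : ∀ {Γ A} → (A ∷ Γ) ⊢ v₀ ∶ A
  ⊢v₀ = ⊢var here
  ⊢v₁ : ∀ {Γ A B} → (B ∷ A ∷ Γ) ⊢ v₁ ∶ A
  ⊢v₁ = ⊢var (there here)

  ∘-resp : ∀ {A B C f f' g g'} → (B ∷ []) ⊢ f ≡ f' ∶ C → (A ∷ []) ⊢ g ≡ g' ∶ B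
         → (A ∷ []) ⊢ f [ g ]₀ ≡ f' [ g' ]₀ ∶ C
  ∘-resp p q = ≡-sub (single-⊢ˢ (proj₁ (≡-regular q))) p ⟫ []₀-≡ (proj₂ (≡-regular p)) q

  isCategory : IsCategory SynCat
  isCategory = record
    { ≈ₒ-equiv = record { refl = ≐-refl ; sym = ≐-sym ; trans = ≐-trans }
    ; ≈-equiv  = record { refl = λ {f} → ≡-refl (proj₂ f) ; sym = ≡-sym ; trans = ≡-trans }
    ; ∘-resp   = ∘-resp
    ; idˡ      = λ f → ≡-refl (proj₂ f)
    ; idʳ      = λ f → ≡-refl (proj₂ (f ∘ₛ idₛ)) ⟫≣ sub-var₁ (proj₂ f) refl
    ; assoc    = λ h g f → ≡-refl (proj₂ ((h ∘ₛ g) ∘ₛ f)) ⟫≣ sub-sub₁ (σ₀ (proj₁ f)) (σ₀ (proj₁ g)) (proj₂ h)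
    ; coe-id   = λ p → ≡-refl ⊢v₀
    ; coe-∘    = λ p q r → ≡-refl (⊢conv r ⊢v₀)
    }

  pair-⊢ : ∀ {Γ A B} → (B ∷ A ∷ Γ) ⊢ pair v₁ v₀ ∶ A ⊠ B
  pair-⊢ = ⊢pair ⊢v₁ ⊢v₀

  ev-β : ∀ {C A B} (f : Hom (C ⊠ A) B) → ((C ⊠ A) ∷ []) ⊢ proj₁ (ev ∘ₛ (curry f ×₁ idₛ)) ≡ proj₁ f ∶ B
  ev-β {C} {A} {B} (f , df) = begin
    app (fst (pair (lam A F) (snd v₀))) (snd (pair (lam A F) (snd v₀)))
      ∼⟨ ≡-app (≡-fstβ (⊢lam dF) ⊢snd₀) (≡-sndβ (⊢lam dF) ⊢snd₀) ⟩
    app (lam A F) (snd v₀)                 ∼⟨ ≡-⇒β dF ⊢snd₀ ⟩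
    F [ snd v₀ ]₀                          ≡⟨ sub-sub-sub₁ (σ₀ (snd v₀)) (exts (σ₀ (fst v₀))) (σ₀ (pair v₁ v₀)) df ⟩
    f [ pair (fst v₀) (snd v₀) ]₀          ∼⟨ []₀-≡ df (≡-⊠η ⊢v₀) ⟩
    f [ v₀ ]₀                              ≡⟨ sub-var₁ df refl ⟩
    f                                      ∎
    where
    open ⊢≡-Reasoning
    F : Term
    F = sub (exts (σ₀ (fst v₀))) (sub (σ₀ (pair v₁ v₀)) f)
    ⊢snd₀ : ((C ⊠ A) ∷ []) ⊢ snd v₀ ∶ A
    ⊢snd₀ = ⊢snd ⊢v₀
    dF : (A ∷ (C ⊠ A) ∷ []) ⊢ F ∶ B
    dF = sub-⊢ (exts-⊢ (single-⊢ˢ (⊢fst ⊢v₀))) (sub-⊢ (single-⊢ˢ pair-⊢) df)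

  curry-η : ∀ {C A B} (g : Hom C (A ⇒ B)) → (C ∷ []) ⊢ proj₁ (curry (ev ∘ₛ (g ×₁ idₛ))) ≡ proj₁ g ∶ A ⇒ B
  curry-η {C} {A} {B} (g , dg) = ≡-lam body ⟫ ≡-⇒η dg
    where
    open ⊢≡-Reasoning
    g′ : Term
    g′ = sub (σ₀ (pair v₁ v₀)) (g [ fst v₀ ]₀)
    dG : (A ∷ C ∷ []) ⊢ g′ ∶ A ⇒ B
    dG = sub-⊢ (single-⊢ˢ pair-⊢) (single-⊢ dg (⊢fst ⊢v₀))
    body : (A ∷ C ∷ []) ⊢ app (fst (pair g′ (snd (pair v₁ v₀)))) (snd (pair g′ (snd (pair v₁ v₀))))
                         ≡ app (ren suc g) v₀ ∶ B
    body = begin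
      app (fst (pair g′ (snd (pair v₁ v₀)))) (snd (pair g′ (snd (pair v₁ v₀))))
        ∼⟨ ≡-app (≡-fstβ dG (⊢snd pair-⊢)) (≡-sndβ dG (⊢snd pair-⊢)) ⟩
      app g′ (snd (pair v₁ v₀))
        ≡⟨ cong (λ t → app t _) (sub-sub₁ (σ₀ (pair v₁ v₀)) (σ₀ (fst v₀)) dg) ⟩
      app (g [ fst (pair v₁ v₀) ]₀) (snd (pair v₁ v₀))
        ∼⟨ ≡-app ([]₀-≡ dg (≡-fstβ ⊢v₁ ⊢v₀)) (≡-sndβ ⊢v₁ ⊢v₀) ⟩
      app (g [ v₁ ]₀) v₀                            ≡⟨ cong (λ t → app t v₀) (PE.sym (ren₁ suc dg)) ⟩
      app (ren suc g) v₀                            ∎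

  coe-⇛ : ∀ {A A' B B'} (p : A ≐ A') (p' : A' ≐ A) (q : B ≐ B')
        → ((A ⇒ B) ∷ []) ⊢ v₀ ≡ proj₁ (curry ((v₀ , ⊢conv q ⊢v₀) ∘ₛ (ev ∘ₛ (idₛ ×₁ (v₀ , ⊢conv p' ⊢v₀)))))
                         ∶ A' ⇒ B'
  coe-⇛ {A} {A'} {B} p p' q = ≡-sym (≡-lam (≡-conv q (≡-app fun arg)) ⟫ ≡-⇒η (⊢conv (≐-⇒ p q) ⊢v₀))
    where
    P : Term
    P = pair (fst (pair v₁ v₀)) (snd (pair v₁ v₀))
    dP₁ : (A' ∷ (A ⇒ B) ∷ []) ⊢ fst (pair v₁ v₀) ∶ A ⇒ B
    dP₁ = ⊢fst pair-⊢
    dP₂ : (A' ∷ (A ⇒ B) ∷ []) ⊢ snd (pair v₁ v₀) ∶ A'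
    dP₂ = ⊢snd pair-⊢
    fun : (A' ∷ (A ⇒ B) ∷ []) ⊢ fst P ≡ v₁ ∶ A ⇒ B
    fun = ≡-fstβ dP₁ dP₂ ⟫ ≡-fstβ ⊢v₁ ⊢v₀
    arg : (A' ∷ (A ⇒ B) ∷ []) ⊢ snd P ≡ v₀ ∶ A
    arg = ≡-conv p' (≡-sndβ dP₁ dP₂ ⟫ ≡-sndβ ⊢v₁ ⊢v₀)

  isCCC : IsCCC SynCat SynCCC
  isCCC = record
    { !-unique   = λ f → ≡-𝟙η (proj₂ f)
    ; π₁-β       = λ f g → ≡-fstβ (proj₂ f) (proj₂ g)
    ; π₂-β       = λ f g → ≡-sndβ (proj₂ f) (proj₂ g)
    ; ⟨⟩-η       = λ h → ≡-⊠η (proj₂ h)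
    ; ⟨⟩-resp    = ≡-pair
    ; ev-β       = ev-β
    ; curry-η    = curry-η
    ; curry-resp = λ p → ≡-lam (≡-sub (single-⊢ˢ pair-⊢) p)
    ; ⊗-resp     = ≐-⊠
    ; coe-⊗      = λ p q → ≡-sym (≡-⊠η (⊢conv (≐-⊠ p q) ⊢v₀))
    ; ⇛-resp     = ≐-⇒
    ; coe-⇛      = coe-⇛
    }

  bind-congˡ : ∀ {Γ X A B M M' N} → Γ ⊢ M ≡ M' ∶ 𝕄 X A → (A ∷ Γ) ⊢ N ∶ 𝕄 X B
             → Γ ⊢ bind X M N ≡ bind X M' N ∶ 𝕄 X B
  bind-congˡ p d = ≡-bind p (≡-refl d)

  bind-congʳ : ∀ {Γ X A B M N N'} → Γ ⊢ M ∶ 𝕄 X A → (A ∷ Γ) ⊢ N ≡ N' ∶ 𝕄 X B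
             → Γ ⊢ bind X M N ≡ bind X M N' ∶ 𝕄 X B
  bind-congʳ d p = ≡-bind (≡-refl d) p

  module SynMonadLaws (X : Mon) where
    open MonadData (SynMonad X)
    open ⊢≡-Reasoning

    F₁-term : ∀ {A B} (f : Hom A B) → proj₁ (F₁ f) ≣ bind X v₀ (ret X (proj₁ f))
    F₁-term (f , df) = cong (λ t → bind X v₀ (ret X t)) (sub-var₁ df refl)

    F₁-∘ : ∀ {A B} (f : Hom A B) t → proj₁ (F₁ f) [ t ]₀ ≣ bind X t (ret X (proj₁ f))
    F₁-∘ (f , df) t = cong (λ u → bind X t (ret X u)) (PE.trans (sub-sub₁ (exts (σ₀ t)) (σ₀ v₀) df) (sub-var₁ df refl))

    F-∘ : ∀ {A B C} (g : Hom B C) (f : Hom A B)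
        → (𝕄 X A ∷ []) ⊢ proj₁ (F₁ (g ∘ₛ f)) ≡ proj₁ (F₁ g ∘ₛ F₁ f) ∶ 𝕄 X C
    F-∘ (g , dg) (f , df) = ≡-sym (begin
      proj₁ (F₁ (g , dg)) [ proj₁ (F₁ (f , df)) ]₀     ≡⟨ F₁-∘ (g , dg) _ ⟩
      bind X (proj₁ (F₁ (f , df))) (ret X g)           ≡⟨ cong (λ t → bind X t (ret X g)) (F₁-term (f , df)) ⟩
      bind X (bind X v₀ (ret X f)) (ret X g)           ∼⟨ ≡-assoc ⊢v₀ (⊢ret (⊢₁-weaken df)) (⊢ret (⊢₁-weaken dg)) ⟩
      bind X v₀ (bind X (ret X f) (ret X (ren (ext suc) g)))
        ∼⟨ bind-congʳ ⊢v₀ (≡-retβ (⊢₁-weaken df) (⊢ret (ren-⊢ (ext-∋ there) (⊢₁-weaken dg)))) ⟩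
      bind X v₀ (ret X (sub (σ₀ f) (ren (ext suc) g)))  ≡⟨ cong (λ t → bind X v₀ (ret X t)) (sub-ren₁ (σ₀ f) (ext suc) dg) ⟩
      bind X v₀ (ret X (g [ f ]₀))                      ≡⟨ PE.sym (F₁-term (_ , single-⊢ dg df)) ⟩
      proj₁ (F₁ ((g , dg) ∘ₛ (f , df)))                 ∎)

    η-nat : ∀ {A B} (f : Hom A B) → (A ∷ []) ⊢ proj₁ (η ∘ₛ f) ≡ proj₁ (F₁ f ∘ₛ η) ∶ 𝕄 X B
    η-nat (f , df) =
      ≡-sym (F₁-∘ (f , df) (ret X v₀) ≣⟫ ≡-retβ ⊢v₀ (⊢ret (⊢₁-weaken df)) ⟫≣ cong (ret X) (sub-var₁ df refl))

    μ-nat : ∀ {A B} (f : Hom A B)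
          → (𝕄 X (𝕄 X A) ∷ []) ⊢ proj₁ (μ ∘ₛ F₁ (F₁ f)) ≡ proj₁ (F₁ f ∘ₛ μ) ∶ 𝕄 X B
    μ-nat {A} {B} (f , df) = begin
      bind X (proj₁ (F₁ (F₁ (f , df)))) v₀                  ≡⟨ cong (λ t → bind X t v₀) (F₁-term (F₁ (f , df))) ⟩
      bind X (bind X v₀ (ret X (proj₁ (F₁ (f , df))))) v₀   ∼⟨ ≡-assoc ⊢v₀ (⊢ret (⊢₁-weaken dFf)) ⊢v₀ ⟩
      bind X v₀ (bind X (ret X (proj₁ (F₁ (f , df)))) v₀)  ∼⟨ bind-congʳ ⊢v₀ (≡-retβ (⊢₁-weaken dFf) ⊢v₀) ⟩
      bind X v₀ (proj₁ (F₁ (f , df)))                       ≡⟨ cong (bind X v₀) (F₁-term (f , df)) ⟩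
      bind X v₀ (bind X v₀ (ret X f))
        ≡⟨ cong (λ t → bind X v₀ (bind X v₀ (ret X t))) (PE.sym (PE.trans (ren₁ (ext suc) df) (sub-var₁ df refl))) ⟩
      bind X v₀ (bind X v₀ (ret X (ren (ext suc) f)))       ∼⟨ ≡-sym (≡-assoc ⊢v₀ ⊢v₀ (⊢ret (⊢₁-weaken df))) ⟩
      bind X (bind X v₀ v₀) (ret X f)                       ≡⟨ PE.sym (F₁-∘ (f , df) _) ⟩
      proj₁ (F₁ (f , df) ∘ₛ μ)                              ∎
      where
      dFf : (𝕄 X A ∷ []) ⊢ proj₁ (F₁ (f , df)) ∶ 𝕄 X B
      dFf = proj₂ (F₁ (f , df))

    τ₀ : Term
    τ₀ = bind X (snd v₀) (ret X (pair (fst v₁) v₀))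

    ⊢pair-fst₁ : ∀ {Γ A B C} → (B ∷ (A ⊠ C) ∷ Γ) ⊢ pair (fst v₁) v₀ ∶ A ⊠ B
    ⊢pair-fst₁ = ⊢pair (⊢fst ⊢v₁) ⊢v₀

    ⊢τ₀ : ∀ {Γ A B} → ((A ⊠ 𝕄 X B) ∷ Γ) ⊢ τ₀ ∶ 𝕄 X (A ⊠ B)
    ⊢τ₀ = ⊢bind (⊢snd ⊢v₀) (⊢ret ⊢pair-fst₁)

    τ-∘⟨⟩ : ∀ {Γ A B a m} → Γ ⊢ a ∶ A → Γ ⊢ m ∶ 𝕄 X B
          → Γ ⊢ τ₀ [ pair a m ]₀ ≡ bind X m (ret X (pair (ren suc a) v₀)) ∶ 𝕄 X (A ⊠ B)
    τ-∘⟨⟩ {a = a} {m} da dm = begin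
      bind X (snd (pair a m)) (ret X (pair (fst (pair (ren suc a) (ren suc m))) v₀))
        ∼⟨ bind-congˡ (≡-sndβ da dm) (⊢ret (⊢pair (⊢fst (wk-⊢ (⊢pair da dm))) ⊢v₀)) ⟩
      bind X m (ret X (pair (fst (pair (ren suc a) (ren suc m))) v₀))
        ∼⟨ bind-congʳ dm (≡-ret (≡-pair (≡-fstβ (wk-⊢ da) (wk-⊢ dm)) (≡-refl ⊢v₀))) ⟩
      bind X m (ret X (pair (ren suc a) v₀))
        ∎

    τ-nat : ∀ {A A' B B'} (f : Hom A A') (g : Hom B B')
          → ((A ⊠ 𝕄 X B) ∷ []) ⊢ proj₁ (τ ∘ₛ (f ×₁ F₁ g)) ≡ proj₁ (F₁ (f ×₁ g) ∘ₛ τ) ∶ 𝕄 X (A' ⊠ B')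
    τ-nat {A} {A'} {B} {B'} (f , df) (g , dg) = lhs ⟫ ≡-sym rhs
      where
      a m : Term
      a = f [ fst v₀ ]₀
      m = proj₁ (F₁ (g , dg)) [ snd v₀ ]₀
      da : ((A ⊠ 𝕄 X B) ∷ []) ⊢ a ∶ A'
      da = single-⊢ df (⊢fst ⊢v₀)
      dm : ((A ⊠ 𝕄 X B) ∷ []) ⊢ m ∶ 𝕄 X B'
      dm = single-⊢ (proj₂ (F₁ (g , dg))) (⊢snd ⊢v₀)
      df₁ : ∀ {C} → (C ∷ (A ⊠ 𝕄 X B) ∷ []) ⊢ f [ fst v₁ ]₀ ∶ A'
      df₁ = single-⊢ df (⊢fst ⊢v₁)
      lhs : ((A ⊠ 𝕄 X B) ∷ []) ⊢ proj₁ (τ ∘ₛ ((f , df) ×₁ F₁ (g , dg)))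
                                ≡ bind X (snd v₀) (ret X (pair (f [ fst v₁ ]₀) g)) ∶ 𝕄 X (A' ⊠ B')
      lhs = begin
        τ₀ [ pair a m ]₀
          ∼⟨ τ-∘⟨⟩ da dm ⟩
        bind X m (ret X (pair (ren suc a) v₀))
          ≡⟨ cong₂ (λ t u → bind X t (ret X (pair u v₀))) (F₁-∘ (g , dg) (snd v₀)) (ren-sub₁ suc (σ₀ (fst v₀)) df) ⟩
        bind X (bind X (snd v₀) (ret X g)) (ret X (pair (f [ fst v₁ ]₀) v₀))
          ∼⟨ ≡-assoc (⊢snd ⊢v₀) (⊢ret (⊢₁-weaken dg)) (⊢ret (⊢pair df₁ ⊢v₀)) ⟩
        bind X (snd v₀) (bind X (ret X g) (ret X (pair (ren (ext suc) (f [ fst v₁ ]₀)) v₀)))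
          ∼⟨ bind-congʳ (⊢snd ⊢v₀) (≡-retβ (⊢₁-weaken dg) (ren-⊢ (ext-∋ there) (⊢ret (⊢pair df₁ ⊢v₀)))) ⟩
        bind X (snd v₀) (ret X (pair (sub (σ₀ g) (ren (ext suc) (f [ fst v₁ ]₀))) g))
          ≡⟨ cong (λ t → bind X (snd v₀) (ret X (pair t g))) (sub-ren-sub₁ (σ₀ g) (ext suc) (σ₀ (fst v₁)) df) ⟩
        bind X (snd v₀) (ret X (pair (f [ fst v₁ ]₀) g))
          ∎
      fg : Hom (A ⊠ B) (A' ⊠ B')
      fg = (f , df) ×₁ (g , dg)
      rhs : ((A ⊠ 𝕄 X B) ∷ []) ⊢ proj₁ (F₁ fg ∘ₛ τ)
                                ≡ bind X (snd v₀) (ret X (pair (f [ fst v₁ ]₀) g)) ∶ 𝕄 X (A' ⊠ B')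
      rhs = begin
        proj₁ (F₁ fg ∘ₛ τ)
          ≡⟨ F₁-∘ fg τ₀ ⟩
        bind X τ₀ (ret X (proj₁ fg))
          ∼⟨ ≡-assoc (⊢snd ⊢v₀) (⊢ret ⊢pair-fst₁) (⊢ret (⊢₁-weaken (proj₂ fg))) ⟩
        bind X (snd v₀) (bind X (ret X (pair (fst v₁) v₀)) (ret X (ren (ext suc) (proj₁ fg))))
          ∼⟨ bind-congʳ (⊢snd ⊢v₀) (≡-retβ ⊢pair-fst₁ (ren-⊢ (ext-∋ there) (⊢ret (⊢₁-weaken (proj₂ fg))))) ⟩
        bind X (snd v₀) (ret X (sub (σ₀ (pair (fst v₁) v₀)) (ren (ext suc) (proj₁ fg))))
          ≡⟨ cong₂ (λ t u → bind X (snd v₀) (ret X (pair t u)))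
                   (sub-ren-sub₁ (σ₀ (pair (fst v₁) v₀)) (ext suc) (σ₀ (fst v₀)) df)
                   (sub-ren-sub₁ (σ₀ (pair (fst v₁) v₀)) (ext suc) (σ₀ (snd v₀)) dg) ⟩
        bind X (snd v₀) (ret X (pair (f [ fst (pair (fst v₁) v₀) ]₀) (g [ snd (pair (fst v₁) v₀) ]₀)))
          ∼⟨ bind-congʳ (⊢snd ⊢v₀) (≡-ret (≡-pair ([]₀-≡ df (≡-fstβ (⊢fst ⊢v₁) ⊢v₀))
                                                  ([]₀-≡ dg (≡-sndβ (⊢fst ⊢v₁) ⊢v₀)))) ⟩
        bind X (snd v₀) (ret X (pair (f [ fst v₁ ]₀) (g [ v₀ ]₀)))
          ≡⟨ cong (λ t → bind X (snd v₀) (ret X (pair (f [ fst v₁ ]₀) t))) (sub-var₁ dg refl) ⟩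
        bind X (snd v₀) (ret X (pair (f [ fst v₁ ]₀) g))
          ∎

    -- Definitionally the term of τ' = F₁ swap⊗ ∘ (τ ∘ swap⊗).
    τ'₀ : Term
    τ'₀ = bind X (τ₀ [ pair (snd v₀) (fst v₀) ]₀) (ret X (pair (snd v₀) (fst v₀)))

    ⊢τ'₀ : ∀ {Γ A B} → ((𝕄 X A ⊠ B) ∷ Γ) ⊢ τ'₀ ∶ 𝕄 X (A ⊠ B)
    ⊢τ'₀ = ⊢bind ([]₀-⊢ ⊢τ₀ (⊢pair (⊢snd ⊢v₀) (⊢fst ⊢v₀))) (⊢ret (⊢pair (⊢snd ⊢v₀) (⊢fst ⊢v₀)))

    τ'-∘⟨⟩ : ∀ {Γ A B m b} → Γ ⊢ m ∶ 𝕄 X A → Γ ⊢ b ∶ B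
           → Γ ⊢ τ'₀ [ pair m b ]₀ ≡ bind X m (ret X (pair v₀ (ren suc b))) ∶ 𝕄 X (A ⊠ B)
    τ'-∘⟨⟩ {m = m} {b} dm db = begin
      bind X (τ₀ [ pair (snd (pair m b)) (fst (pair m b)) ]₀) (ret X (pair (snd v₀) (fst v₀)))
        ∼⟨ bind-congˡ ([]₀-≡ ⊢τ₀ (≡-pair (≡-sndβ dm db) (≡-fstβ dm db)) ⟫ τ-∘⟨⟩ db dm) ⊢swap ⟩
      bind X (bind X m (ret X (pair (ren suc b) v₀))) (ret X (pair (snd v₀) (fst v₀)))
        ∼⟨ ≡-assoc dm (⊢ret (⊢pair (wk-⊢ db) ⊢v₀)) ⊢swap ⟩
      bind X m (bind X (ret X (pair (ren suc b) v₀)) (ret X (pair (snd v₀) (fst v₀))))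
        ∼⟨ bind-congʳ dm (≡-retβ (⊢pair (wk-⊢ db) ⊢v₀) ⊢swap) ⟩
      bind X m (ret X (pair (snd (pair (ren suc b) v₀)) (fst (pair (ren suc b) v₀))))
        ∼⟨ bind-congʳ dm (≡-ret (≡-pair (≡-sndβ (wk-⊢ db) ⊢v₀) (≡-fstβ (wk-⊢ db) ⊢v₀))) ⟩
      bind X m (ret X (pair v₀ (ren suc b)))
        ∎
      where
      ⊢swap : ∀ {Γ C D} → ((C ⊠ D) ∷ Γ) ⊢ ret X (pair (snd v₀) (fst v₀)) ∶ 𝕄 X (D ⊠ C)
      ⊢swap = ⊢ret (⊢pair (⊢snd ⊢v₀) (⊢fst ⊢v₀))

    μ-assoc : ∀ {A} → (𝕄 X (𝕄 X (𝕄 X A)) ∷ []) ⊢ proj₁ (μ {A} ∘ₛ F₁ μ) ≡ proj₁ (μ {A} ∘ₛ μ) ∶ 𝕄 X A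
    μ-assoc = begin
      bind X (bind X v₀ (ret X (bind X v₀ v₀))) v₀  ∼⟨ ≡-assoc ⊢v₀ (⊢ret (⊢bind ⊢v₀ ⊢v₀)) ⊢v₀ ⟩
      bind X v₀ (bind X (ret X (bind X v₀ v₀)) v₀)  ∼⟨ bind-congʳ ⊢v₀ (≡-retβ (⊢bind ⊢v₀ ⊢v₀) ⊢v₀) ⟩
      bind X v₀ (bind X v₀ v₀)                      ∼⟨ ≡-sym (≡-assoc ⊢v₀ ⊢v₀ ⊢v₀) ⟩
      bind X (bind X v₀ v₀) v₀                      ∎

    μ-idʳ : ∀ {A} → (𝕄 X A ∷ []) ⊢ proj₁ (μ {A} ∘ₛ F₁ η) ≡ v₀ ∶ 𝕄 X A
    μ-idʳ = begin
      bind X (bind X v₀ (ret X (ret X v₀))) v₀      ∼⟨ ≡-assoc ⊢v₀ (⊢ret (⊢ret ⊢v₀)) ⊢v₀ ⟩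
      bind X v₀ (bind X (ret X (ret X v₀)) v₀)      ∼⟨ bind-congʳ ⊢v₀ (≡-retβ (⊢ret ⊢v₀) ⊢v₀) ⟩
      bind X v₀ (ret X v₀)                          ∼⟨ ≡-retη ⊢v₀ ⟩
      v₀                                            ∎

    τ-unit : ∀ {A} → ((𝟙 ⊠ 𝕄 X A) ∷ []) ⊢ proj₁ (F₁ π₂ ∘ₛ τ {𝟙} {A}) ≡ snd v₀ ∶ 𝕄 X A
    τ-unit = begin
      bind X τ₀ (ret X (snd v₀))
        ∼⟨ ≡-assoc (⊢snd ⊢v₀) (⊢ret ⊢pair-fst₁) (⊢ret (⊢snd ⊢v₀)) ⟩
      bind X (snd v₀) (bind X (ret X (pair (fst v₁) v₀)) (ret X (snd v₀)))
        ∼⟨ bind-congʳ (⊢snd ⊢v₀) (≡-retβ ⊢pair-fst₁ (⊢ret (⊢snd ⊢v₀)) ⟫ ≡-ret (≡-sndβ (⊢fst ⊢v₁) ⊢v₀)) ⟩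
      bind X (snd v₀) (ret X v₀)
        ∼⟨ ≡-retη (⊢snd ⊢v₀) ⟩
      snd v₀
        ∎

    τ-η : ∀ {A B} → ((A ⊠ B) ∷ []) ⊢ proj₁ (τ {A} {B} ∘ₛ (idₛ ×₁ η)) ≡ ret X v₀ ∶ 𝕄 X (A ⊠ B)
    τ-η = begin
      τ₀ [ pair (fst v₀) (ret X (snd v₀)) ]₀
        ∼⟨ τ-∘⟨⟩ (⊢fst ⊢v₀) (⊢ret (⊢snd ⊢v₀)) ⟩
      bind X (ret X (snd v₀)) (ret X (pair (fst v₁) v₀))
        ∼⟨ ≡-retβ (⊢snd ⊢v₀) (⊢ret ⊢pair-fst₁) ⟩
      ret X (pair (fst v₀) (snd v₀))
        ∼⟨ ≡-ret (≡-⊠η ⊢v₀) ⟩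
      ret X v₀
        ∎

    τ-μ : ∀ {A B} → ((A ⊠ 𝕄 X (𝕄 X B)) ∷ []) ⊢ proj₁ (τ {A} {B} ∘ₛ (idₛ ×₁ μ))
                                             ≡ proj₁ (μ ∘ₛ (F₁ (τ {A} {B}) ∘ₛ τ)) ∶ 𝕄 X (A ⊠ B)
    τ-μ = begin
      τ₀ [ pair (fst v₀) (bind X (snd v₀) v₀) ]₀
        ∼⟨ τ-∘⟨⟩ (⊢fst ⊢v₀) (⊢bind (⊢snd ⊢v₀) ⊢v₀) ⟩
      bind X (bind X (snd v₀) v₀) (ret X (pair (fst v₁) v₀))
        ∼⟨ ≡-assoc (⊢snd ⊢v₀) ⊢v₀ (⊢ret ⊢pair-fst₁) ⟩
      bind X (snd v₀) (bind X v₀ (ret X (pair (fst v₂) v₀)))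
        ∼⟨ bind-congʳ (⊢snd ⊢v₀) (≡-sym (τ-∘⟨⟩ (⊢fst ⊢v₁) ⊢v₀)) ⟩
      bind X (snd v₀) (τ₀ [ pair (fst v₁) v₀ ]₀)
        ∼⟨ ≡-sym (bind-congʳ (⊢snd ⊢v₀) (≡-retβ ⊢pair-fst₁ ⊢τ₀)) ⟩
      bind X (snd v₀) (bind X (ret X (pair (fst v₁) v₀)) τ₀)
        ∼⟨ ≡-sym (≡-assoc (⊢snd ⊢v₀) (⊢ret ⊢pair-fst₁) ⊢τ₀) ⟩
      bind X τ₀ τ₀
        ∼⟨ ≡-sym (bind-congʳ ⊢τ₀ (≡-retβ ⊢τ₀ ⊢v₀)) ⟩
      bind X τ₀ (bind X (ret X τ₀) v₀)
        ∼⟨ ≡-sym (≡-assoc ⊢τ₀ (⊢ret ⊢τ₀) ⊢v₀) ⟩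
      bind X (bind X τ₀ (ret X τ₀)) v₀
        ∎

    τ-assoc : ∀ {A B C} → (((A ⊠ B) ⊠ 𝕄 X C) ∷ []) ⊢ proj₁ (F₁ assoc⊗ ∘ₛ τ {A ⊠ B} {C})
                                                   ≡ proj₁ (τ ∘ₛ ((idₛ {A} ×₁ τ {B} {C}) ∘ₛ assoc⊗)) ∶ 𝕄 X (A ⊠ (B ⊠ C))
    τ-assoc {A} {B} {C} = lhs ⟫ ≡-sym rhs
      where
      α₀ α₁ : Term
      α₀ = pair (fst (fst v₀)) (pair (snd (fst v₀)) (snd v₀))
      α₁ = pair (fst (fst v₁)) (pair (snd (fst v₁)) (snd v₁))
      ⊢α₀ : ∀ {Γ D} → (((A ⊠ B) ⊠ D) ∷ Γ) ⊢ α₀ ∶ A ⊠ (B ⊠ D)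
      ⊢α₀ = ⊢pair (⊢fst (⊢fst ⊢v₀)) (⊢pair (⊢snd (⊢fst ⊢v₀)) (⊢snd ⊢v₀))
      target : Term
      target = bind X (snd v₀) (ret X (pair (fst (fst v₁)) (pair (snd (fst v₁)) v₀)))
      lhs : (((A ⊠ B) ⊠ 𝕄 X C) ∷ []) ⊢ bind X τ₀ (ret X α₀) ≡ target ∶ 𝕄 X (A ⊠ (B ⊠ C))
      lhs = begin
        bind X τ₀ (ret X α₀)
          ∼⟨ ≡-assoc (⊢snd ⊢v₀) (⊢ret ⊢pair-fst₁) (⊢ret ⊢α₀) ⟩
        bind X (snd v₀) (bind X (ret X (pair (fst v₁) v₀)) (ret X α₀))
          ∼⟨ bind-congʳ (⊢snd ⊢v₀) (≡-retβ ⊢pair-fst₁ (⊢ret ⊢α₀)) ⟩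
        bind X (snd v₀) (ret X (α₀ [ pair (fst v₁) v₀ ]₀))
          ∼⟨ bind-congʳ (⊢snd ⊢v₀) (≡-ret (≡-pair (≡-fst (≡-fstβ (⊢fst ⊢v₁) ⊢v₀))
                                                  (≡-pair (≡-snd (≡-fstβ (⊢fst ⊢v₁) ⊢v₀)) (≡-sndβ (⊢fst ⊢v₁) ⊢v₀)))) ⟩
        target
          ∎
      β₁ : ∀ {D} → (D ∷ ((A ⊠ B) ⊠ 𝕄 X C) ∷ []) ⊢ fst α₁ ≡ fst (fst v₁) ∶ A
      β₁ = ≡-fstβ (⊢fst (⊢fst ⊢v₁)) (⊢pair (⊢snd (⊢fst ⊢v₁)) (⊢snd ⊢v₁))
      rhs : (((A ⊠ B) ⊠ 𝕄 X C) ∷ []) ⊢ τ₀ [ pair (fst α₀) (τ₀ [ snd α₀ ]₀) ]₀ ≡ target ∶ 𝕄 X (A ⊠ (B ⊠ C))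
      rhs = begin
        τ₀ [ pair (fst α₀) (τ₀ [ snd α₀ ]₀) ]₀
          ∼⟨ τ-∘⟨⟩ (⊢fst ⊢α₀) ([]₀-⊢ ⊢τ₀ (⊢snd ⊢α₀)) ⟩
        bind X (τ₀ [ snd α₀ ]₀) (ret X (pair (fst α₁) v₀))
          ∼⟨ bind-congˡ ([]₀-≡ ⊢τ₀ (≡-sndβ (⊢fst (⊢fst ⊢v₀)) (⊢pair (⊢snd (⊢fst ⊢v₀)) (⊢snd ⊢v₀)))
                          ⟫ τ-∘⟨⟩ (⊢snd (⊢fst ⊢v₀)) (⊢snd ⊢v₀))
                        (⊢ret (⊢pair (⊢fst (wk-⊢ ⊢α₀)) ⊢v₀)) ⟩
        bind X (bind X (snd v₀) (ret X (pair (snd (fst v₁)) v₀))) (ret X (pair (fst α₁) v₀))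
          ∼⟨ ≡-assoc (⊢snd ⊢v₀) (⊢ret (⊢pair (⊢snd (⊢fst ⊢v₁)) ⊢v₀)) (⊢ret (⊢pair (⊢fst (wk-⊢ ⊢α₀)) ⊢v₀)) ⟩
        bind X (snd v₀) (bind X (ret X (pair (snd (fst v₁)) v₀)) (ret X (pair (fst (ren (ext suc) α₁)) v₀)))
          ∼⟨ bind-congʳ (⊢snd ⊢v₀) (≡-retβ (⊢pair (⊢snd (⊢fst ⊢v₁)) ⊢v₀)
                                           (⊢ret (⊢pair (⊢fst (ren-⊢ (ext-∋ there) (wk-⊢ ⊢α₀))) ⊢v₀))) ⟩
        bind X (snd v₀) (ret X (pair (fst α₁) (pair (snd (fst v₁)) v₀)))
          ∼⟨ bind-congʳ (⊢snd ⊢v₀) (≡-ret (≡-pair β₁ (≡-refl (⊢pair (⊢snd (⊢fst ⊢v₁)) ⊢v₀)))) ⟩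
        target
          ∎

    isStrongMonad : IsStrongMonad SynCat SynCCC (SynMonad X)
    isStrongMonad = record
      { F-id     = ≡-retη ⊢v₀
      ; F-∘      = F-∘
      ; F-resp   = λ p → bind-congʳ ⊢v₀ (≡-ret (≡-sub (single-⊢ˢ ⊢v₀) p))
      ; F-resp-ₒ = ≐-𝕄
      ; F-coe    = λ p → ≡-conv (≐-𝕄 p) (≡-retη ⊢v₀)
      ; η-nat    = η-nat
      ; μ-nat    = μ-nat
      ; τ-nat    = τ-nat
      ; μ-assoc  = μ-assoc
      ; μ-idˡ    = ≡-retβ ⊢v₀ ⊢v₀
      ; μ-idʳ    = μ-idʳ
      ; τ-unit   = τ-unit
      ; τ-assoc  = τ-assoc
      ; τ-η      = τ-η
      ; τ-μ      = τ-μ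
      }

  module T = MonadData (SynMonad 𝒯)
  module S = MonadData (SynMonad 𝒮)
  open SynMonadLaws 𝒯 using (F₁-∘; τ₀; ⊢τ₀; τ-∘⟨⟩; τ'₀; ⊢τ'₀; τ'-∘⟨⟩)
  open ⊢≡-Reasoning

  ιₛ : ∀ {A} → Hom (𝕄 𝒮 A) (𝕄 𝒯 A)
  ιₛ = CSCModelData.ι Syn

  ι-nat : ∀ {A B} (f : Hom A B)
        → (𝕄 𝒮 A ∷ []) ⊢ proj₁ (ιₛ ∘ₛ S.F₁ f) ≡ proj₁ (T.F₁ f ∘ₛ ιₛ) ∶ 𝕄 𝒯 B
  ι-nat (f , df) = ≡-sym (begin
    proj₁ (T.F₁ (f , df) ∘ₛ ιₛ)         ≡⟨ F₁-∘ (f , df) (iota v₀) ⟩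
    bind 𝒯 (iota v₀) (ret 𝒯 f)          ∼⟨ bind-congʳ (⊢iota ⊢v₀) (≡-sym (≡-iota-ret (⊢₁-weaken df))) ⟩
    bind 𝒯 (iota v₀) (iota (ret 𝒮 f))   ∼⟨ ≡-iota-bind ⊢v₀ (⊢ret (⊢₁-weaken df)) ⟩
    iota (bind 𝒮 v₀ (ret 𝒮 f))          ≡⟨ cong iota (PE.sym (SynMonadLaws.F₁-term 𝒮 (f , df))) ⟩
    iota (proj₁ (S.F₁ (f , df)))        ∎)

  ι-μ : ∀ {A} → (𝕄 𝒮 (𝕄 𝒮 A) ∷ []) ⊢ proj₁ (ιₛ {A} ∘ₛ S.μ)
                                    ≡ proj₁ (T.μ {A} ∘ₛ (T.F₁ ιₛ ∘ₛ ιₛ)) ∶ 𝕄 𝒯 A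
  ι-μ = ≡-sym (begin
    bind 𝒯 (bind 𝒯 (iota v₀) (ret 𝒯 (iota v₀))) v₀   ∼⟨ ≡-assoc (⊢iota ⊢v₀) (⊢ret (⊢iota ⊢v₀)) ⊢v₀ ⟩
    bind 𝒯 (iota v₀) (bind 𝒯 (ret 𝒯 (iota v₀)) v₀)   ∼⟨ bind-congʳ (⊢iota ⊢v₀) (≡-retβ (⊢iota ⊢v₀) ⊢v₀) ⟩
    bind 𝒯 (iota v₀) (iota v₀)                       ∼⟨ ≡-iota-bind ⊢v₀ ⊢v₀ ⟩
    iota (bind 𝒮 v₀ v₀)                              ∎)

  ι-τ : ∀ {A B} → ((A ⊠ 𝕄 𝒮 B) ∷ []) ⊢ proj₁ (ιₛ ∘ₛ S.τ {A} {B})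
                                      ≡ proj₁ (T.τ {A} {B} ∘ₛ (idₛ ×₁ ιₛ)) ∶ 𝕄 𝒯 (A ⊠ B)
  ι-τ = ≡-sym (begin
    τ₀ [ pair (fst v₀) (iota (snd v₀)) ]₀
      ∼⟨ τ-∘⟨⟩ (⊢fst ⊢v₀) (⊢iota (⊢snd ⊢v₀)) ⟩
    bind 𝒯 (iota (snd v₀)) (ret 𝒯 (pair (fst v₁) v₀))
      ∼⟨ bind-congʳ (⊢iota (⊢snd ⊢v₀)) (≡-sym (≡-iota-ret (⊢pair (⊢fst ⊢v₁) ⊢v₀))) ⟩
    bind 𝒯 (iota (snd v₀)) (iota (ret 𝒮 (pair (fst v₁) v₀)))
      ∼⟨ ≡-iota-bind (⊢snd ⊢v₀) (⊢ret (⊢pair (⊢fst ⊢v₁) ⊢v₀)) ⟩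
    iota (bind 𝒮 (snd v₀) (ret 𝒮 (pair (fst v₁) v₀)))
      ∎)

  -- Both sides reduce to the two orders of running ι (fst x) and snd x.
  central : ∀ {X Y} → (((𝕄 𝒮 X) ⊠ 𝕄 𝒯 Y) ∷ []) ⊢
      proj₁ (T.μ ∘ₛ (T.F₁ (T.τ' {X} {Y}) ∘ₛ (T.τ ∘ₛ (ιₛ ×₁ idₛ))))
    ≡ proj₁ (T.μ ∘ₛ (T.F₁ (T.τ {X} {Y}) ∘ₛ (T.τ' ∘ₛ (ιₛ ×₁ idₛ)))) ∶ 𝕄 𝒯 (X ⊠ Y)
  central {X} {Y} = lhs ⟫ ≡-sym rhs
    where
    p target : Term
    p = pair (iota (fst v₀)) (snd v₀)
    target = bind 𝒯 (iota (fst v₀)) (bind 𝒯 (snd v₁) (ret 𝒯 (pair v₁ v₀)))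
    ⊢p : ((𝕄 𝒮 X ⊠ 𝕄 𝒯 Y) ∷ []) ⊢ p ∶ 𝕄 𝒯 X ⊠ 𝕄 𝒯 Y
    ⊢p = ⊢pair (⊢iota (⊢fst ⊢v₀)) (⊢snd ⊢v₀)
    ⊢ιfst₁ : ∀ {D} → (D ∷ (𝕄 𝒮 X ⊠ 𝕄 𝒯 Y) ∷ []) ⊢ iota (fst v₁) ∶ 𝕄 𝒯 X
    ⊢ιfst₁ = ⊢iota (⊢fst ⊢v₁)
    ⊢τ₀[p] : ((𝕄 𝒮 X ⊠ 𝕄 𝒯 Y) ∷ []) ⊢ τ₀ [ p ]₀ ∶ 𝕄 𝒯 (𝕄 𝒯 X ⊠ Y)
    ⊢τ₀[p] = []₀-⊢ ⊢τ₀ ⊢p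
    ⊢τ'₀[p] : ((𝕄 𝒮 X ⊠ 𝕄 𝒯 Y) ∷ []) ⊢ τ'₀ [ p ]₀ ∶ 𝕄 𝒯 (X ⊠ 𝕄 𝒯 Y)
    ⊢τ'₀[p] = []₀-⊢ ⊢τ'₀ ⊢p
    lhs : ((𝕄 𝒮 X ⊠ 𝕄 𝒯 Y) ∷ []) ⊢ bind 𝒯 (bind 𝒯 (τ₀ [ p ]₀) (ret 𝒯 τ'₀)) v₀ ≡ target ∶ 𝕄 𝒯 (X ⊠ Y)
    lhs = begin
      bind 𝒯 (bind 𝒯 (τ₀ [ p ]₀) (ret 𝒯 τ'₀)) v₀
        ∼⟨ ≡-assoc ⊢τ₀[p] (⊢ret ⊢τ'₀) ⊢v₀ ⟩
      bind 𝒯 (τ₀ [ p ]₀) (bind 𝒯 (ret 𝒯 τ'₀) v₀)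
        ∼⟨ bind-congʳ ⊢τ₀[p] (≡-retβ ⊢τ'₀ ⊢v₀) ⟩
      bind 𝒯 (τ₀ [ p ]₀) τ'₀
        ∼⟨ bind-congˡ (τ-∘⟨⟩ (⊢iota (⊢fst ⊢v₀)) (⊢snd ⊢v₀)) ⊢τ'₀ ⟩
      bind 𝒯 (bind 𝒯 (snd v₀) (ret 𝒯 (pair (iota (fst v₁)) v₀))) τ'₀
        ∼⟨ ≡-assoc (⊢snd ⊢v₀) (⊢ret (⊢pair ⊢ιfst₁ ⊢v₀)) ⊢τ'₀ ⟩
      bind 𝒯 (snd v₀) (bind 𝒯 (ret 𝒯 (pair (iota (fst v₁)) v₀)) τ'₀)
        ∼⟨ bind-congʳ (⊢snd ⊢v₀) (≡-retβ (⊢pair ⊢ιfst₁ ⊢v₀) ⊢τ'₀) ⟩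
      bind 𝒯 (snd v₀) (τ'₀ [ pair (iota (fst v₁)) v₀ ]₀)
        ∼⟨ bind-congʳ (⊢snd ⊢v₀) (τ'-∘⟨⟩ ⊢ιfst₁ ⊢v₀) ⟩
      bind 𝒯 (snd v₀) (bind 𝒯 (iota (fst v₁)) (ret 𝒯 (pair v₀ v₁)))
        ∼⟨ ≡-sym (≡-central (⊢fst ⊢v₀) (⊢snd ⊢v₀) (⊢ret (⊢pair ⊢v₁ ⊢v₀))) ⟩
      target
        ∎
    rhs : ((𝕄 𝒮 X ⊠ 𝕄 𝒯 Y) ∷ []) ⊢ bind 𝒯 (bind 𝒯 (τ'₀ [ p ]₀) (ret 𝒯 τ₀)) v₀ ≡ target ∶ 𝕄 𝒯 (X ⊠ Y)
    rhs = begin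
      bind 𝒯 (bind 𝒯 (τ'₀ [ p ]₀) (ret 𝒯 τ₀)) v₀
        ∼⟨ ≡-assoc ⊢τ'₀[p] (⊢ret ⊢τ₀) ⊢v₀ ⟩
      bind 𝒯 (τ'₀ [ p ]₀) (bind 𝒯 (ret 𝒯 τ₀) v₀)
        ∼⟨ bind-congʳ ⊢τ'₀[p] (≡-retβ ⊢τ₀ ⊢v₀) ⟩
      bind 𝒯 (τ'₀ [ p ]₀) τ₀
        ∼⟨ bind-congˡ (τ'-∘⟨⟩ (⊢iota (⊢fst ⊢v₀)) (⊢snd ⊢v₀)) ⊢τ₀ ⟩
      bind 𝒯 (bind 𝒯 (iota (fst v₀)) (ret 𝒯 (pair v₀ (snd v₁)))) τ₀
        ∼⟨ ≡-assoc (⊢iota (⊢fst ⊢v₀)) (⊢ret (⊢pair ⊢v₀ (⊢snd ⊢v₁))) ⊢τ₀ ⟩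
      bind 𝒯 (iota (fst v₀)) (bind 𝒯 (ret 𝒯 (pair v₀ (snd v₁))) τ₀)
        ∼⟨ bind-congʳ (⊢iota (⊢fst ⊢v₀)) (≡-retβ (⊢pair ⊢v₀ (⊢snd ⊢v₁)) ⊢τ₀) ⟩
      bind 𝒯 (iota (fst v₀)) (τ₀ [ pair v₀ (snd v₁) ]₀)
        ∼⟨ bind-congʳ (⊢iota (⊢fst ⊢v₀)) (τ-∘⟨⟩ ⊢v₀ (⊢snd ⊢v₁)) ⟩
      target
        ∎

  isCSCModel : IsCSCModel Syn
  isCSCModel = record
    { isCat   = isCategory
    ; isCCC   = isCCC
    ; isT     = SynMonadLaws.isStrongMonad 𝒯
    ; isS     = SynMonadLaws.isStrongMonad 𝒮
    ; ι-nat   = ι-nat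
    ; ι-η     = ≡-iota-ret ⊢v₀
    ; ι-μ     = ι-μ
    ; ι-τ     = ι-τ
    ; ι-mono  = λ f g p → ≡-iota-inj (proj₂ f) (proj₂ g) p
    ; central = central
    }

module CanonicalInterpretation (Th : Theory) (isM : IsCSCModel (Syntactic.Syn Th)) where
  open Equality Th
  open SubstitutionLemmas
  open TypedSubstitution Th
  open Syntactic Th
  open SyntacticModel Th using (v₀; v₁; ⊢v₀; ⊢v₁; pair-⊢; bind-congˡ; bind-congʳ; module SynMonadLaws)
  open Interpretation Th Syn isM
  open Sem (canonical isM)
  open CatData SynCat using (Hom) renaming (_∘_ to _∘ₛ_; id to idₛ)
  open CCCData SynCCC using (⟨_,_⟩)
  open ⊢≡-Reasoning

  ⟦⟧-≐ : ∀ A → ⟦ A ⟧ ≐ A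
  ⟦⟧-≐ A = PE.subst (_≐ A) (PE.sym (⟦gnd⟧ isM A)) ≐-refl

  -- unpack Γ reads the variables of Γ off the single variable of type ⟦ Γ ⟧ᶜ; tuple Γ id is its inverse.
  unpack : Ctx → ℕ → Term
  unpack []      n       = var n
  unpack (B ∷ Γ) zero    = snd v₀
  unpack (B ∷ Γ) (suc n) = unpack Γ n [ fst v₀ ]₀

  ⊢unpack : ∀ {Γ n A} → Γ ∋ n ∶ A → (⟦ Γ ⟧ᶜ ∷ []) ⊢ unpack Γ n ∶ ⟦ A ⟧
  ⊢unpack here      = ⊢snd ⊢v₀
  ⊢unpack (there x) = single-⊢ (⊢unpack x) (⊢fst ⊢v₀)

  unpack-⊢ˢ : ∀ {Γ} → (⟦ Γ ⟧ᶜ ∷ []) ⊢ˢ unpack Γ ∶ Γ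
  unpack-⊢ˢ x = ⊢conv (⟦⟧-≐ _) (⊢unpack x)

  ⟦⟧ᵛ-unpack : ∀ {Γ n A} (x : Γ ∋ n ∶ A) → proj₁ ⟦ x ⟧ᵛ ≣ unpack Γ n
  ⟦⟧ᵛ-unpack here      = refl
  ⟦⟧ᵛ-unpack (there x) = cong (_[ fst v₀ ]₀) (⟦⟧ᵛ-unpack x)

  unpack-curry : ∀ {Γ A} → (⟦ A ⟧ ∷ ⟦ Γ ⟧ᶜ ∷ []) ⊢ˢ sub (σ₀ (pair v₁ v₀)) ∘′ unpack (A ∷ Γ)
                                                  ≡ exts (unpack Γ) ∶ (A ∷ Γ)
  unpack-curry {A = A} here = ≡-conv (⟦⟧-≐ A) (≡-sndβ ⊢v₁ ⊢v₀)
  unpack-curry {Γ} (there {n = n} {A = C} x) = ≡-conv (⟦⟧-≐ C) (begin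
    sub (σ₀ (pair v₁ v₀)) (unpack Γ n [ fst v₀ ]₀)   ≡⟨ sub-sub₁ (σ₀ (pair v₁ v₀)) (σ₀ (fst v₀)) (⊢unpack x) ⟩
    unpack Γ n [ fst (pair v₁ v₀) ]₀                  ∼⟨ []₀-≡ (⊢unpack x) (≡-fstβ ⊢v₁ ⊢v₀) ⟩
    unpack Γ n [ v₁ ]₀                                ≡⟨ PE.sym (ren₁ suc (⊢unpack x)) ⟩
    ren suc (unpack Γ n)                              ∎)

  uncurry-unpack : ∀ {Γ A B M E} → (A ∷ Γ) ⊢ M ∶ B
                 → ((⟦ Γ ⟧ᶜ ⊠ ⟦ A ⟧) ∷ []) ⊢ E ≡ sub (unpack (A ∷ Γ)) M ∶ B
                 → (⟦ A ⟧ ∷ ⟦ Γ ⟧ᶜ ∷ []) ⊢ E [ pair v₁ v₀ ]₀ ≡ sub (exts (unpack Γ)) M ∶ B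
  uncurry-unpack {Γ} {A} {M = M} dM p =
    ≡-sub (single-⊢ˢ pair-⊢) p ⟫ sub-sub (σ₀ (pair v₁ v₀)) (unpack (A ∷ Γ)) M ≣⟫ sub-≡ˢ dM unpack-curry

  bind-unpack : ∀ X {Γ A B M N D E}
                (dD : (⟦ Γ ⟧ᶜ ∷ []) ⊢ D ∶ 𝕄 X ⟦ A ⟧) (dE : ((⟦ Γ ⟧ᶜ ⊠ ⟦ A ⟧) ∷ []) ⊢ E ∶ 𝕄 X ⟦ B ⟧)
              → (A ∷ Γ) ⊢ N ∶ 𝕄 X B
              → (⟦ Γ ⟧ᶜ ∷ []) ⊢ D ≡ sub (unpack Γ) M ∶ 𝕄 X ⟦ A ⟧
              → ((⟦ Γ ⟧ᶜ ⊠ ⟦ A ⟧) ∷ []) ⊢ E ≡ sub (unpack (A ∷ Γ)) N ∶ 𝕄 X ⟦ B ⟧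
              → let open MonadData (SynMonad X) in
                (⟦ Γ ⟧ᶜ ∷ []) ⊢ proj₁ (μ ∘ₛ (F₁ (E , dE) ∘ₛ (τ ∘ₛ ⟨ idₛ , (D , dD) ⟩)))
                              ≡ bind X (sub (unpack Γ) M) (sub (exts (unpack Γ)) N) ∶ 𝕄 X ⟦ B ⟧
  bind-unpack X {Γ} {A} {B} {M} {N} {D} {E} dD dE dN pD pE = begin
    bind X (proj₁ (F₁ (E , dE)) [ t₀ ]₀) v₀               ≡⟨ cong (λ t → bind X t v₀) (F₁-∘ (E , dE) t₀) ⟩
    bind X (bind X t₀ (ret X E)) v₀                       ∼⟨ ≡-assoc ⊢t₀ (⊢ret dE⁺) ⊢v₀ ⟩
    bind X t₀ (bind X (ret X E) v₀)                       ∼⟨ bind-congʳ ⊢t₀ (≡-retβ dE⁺ ⊢v₀) ⟩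
    bind X t₀ E                                           ∼⟨ bind-congˡ (τ-∘⟨⟩ ⊢v₀ dD) dE⁺ ⟩
    bind X (bind X D (ret X (pair v₁ v₀))) E              ∼⟨ ≡-assoc dD (⊢ret pair-⊢) dE⁺ ⟩
    bind X D (bind X (ret X (pair v₁ v₀)) (ren (ext suc) E))
      ∼⟨ bind-congʳ dD (≡-retβ pair-⊢ (ren-⊢ (ext-∋ there) dE⁺)) ⟩
    bind X D (sub (σ₀ (pair v₁ v₀)) (ren (ext suc) E))    ≡⟨ cong (bind X D) (sub-ren₁ (σ₀ (pair v₁ v₀)) (ext suc) dE) ⟩
    bind X D (E [ pair v₁ v₀ ]₀)
      ∼⟨ ≡-bind pD (≡-conv (≐-𝕄 (≐-sym (⟦⟧-≐ B))) (uncurry-unpack dN (≡-conv (≐-𝕄 (⟦⟧-≐ B)) pE))) ⟩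
    bind X (sub (unpack Γ) M) (sub (exts (unpack Γ)) N)   ∎
    where
    open MonadData (SynMonad X)
    open SynMonadLaws X using (F₁-∘; τ₀; ⊢τ₀; τ-∘⟨⟩)
    t₀ : Term
    t₀ = τ₀ [ pair v₀ D ]₀
    ⊢t₀ : (⟦ Γ ⟧ᶜ ∷ []) ⊢ t₀ ∶ 𝕄 X (⟦ Γ ⟧ᶜ ⊠ ⟦ A ⟧)
    ⊢t₀ = []₀-⊢ ⊢τ₀ (⊢pair ⊢v₀ dD)
    dE⁺ : ∀ {C} → ((⟦ Γ ⟧ᶜ ⊠ ⟦ A ⟧) ∷ C ∷ []) ⊢ E ∶ 𝕄 X ⟦ B ⟧
    dE⁺ = ⊢₁-weaken dE

  proj₁-subst : ∀ {B C : Type} (e : B ≣ C) (f : Hom 𝟙 B) → proj₁ (PE.subst (Hom 𝟙) e f) ≣ proj₁ f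
  proj₁-subst refl f = refl

  ⟦⟧ᵗ-unpack : ∀ {Γ M A} (d : Γ ⊢ M ∶ A) → (⟦ Γ ⟧ᶜ ∷ []) ⊢ proj₁ ⟦ d ⟧ᵗ ≡ sub (unpack Γ) M ∶ ⟦ A ⟧
  ⟦⟧ᵗ-unpack (⊢var x)    = ⟦⟧ᵛ-unpack x ≣⟫ ≡-refl (⊢unpack x)
  ⟦⟧ᵗ-unpack (⊢con c)    = cong (_[ ⋆ ]₀) (proj₁-subst (PE.sym (⟦gnd⟧ isM (conTy c))) (con c , ⊢con c))
                           ≣⟫ ≡-refl (⊢conv (≐-sym (⟦⟧-≐ (conTy c))) (⊢con c))
  ⟦⟧ᵗ-unpack ⊢⋆          = ≡-refl ⊢⋆
  ⟦⟧ᵗ-unpack {Γ} (⊢lam {A = A} {B} {M} d) =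
    ≡-lam (≡-conv (≐-sym (⟦⟧-≐ B)) (uncurry-unpack d (≡-conv (⟦⟧-≐ B) (⟦⟧ᵗ-unpack d))))
      ⟫≣ cong (λ C → lam C (sub (exts (unpack Γ)) M)) (⟦gnd⟧ isM A)
  ⟦⟧ᵗ-unpack (⊢app d e)  = ≡-app (≡-fstβ (proj₂ ⟦ d ⟧ᵗ) (proj₂ ⟦ e ⟧ᵗ) ⟫ ⟦⟧ᵗ-unpack d)
                                 (≡-sndβ (proj₂ ⟦ d ⟧ᵗ) (proj₂ ⟦ e ⟧ᵗ) ⟫ ⟦⟧ᵗ-unpack e)
  ⟦⟧ᵗ-unpack (⊢pair d e) = ≡-pair (⟦⟧ᵗ-unpack d) (⟦⟧ᵗ-unpack e)
  ⟦⟧ᵗ-unpack (⊢fst d)    = ≡-fst (⟦⟧ᵗ-unpack d)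
  ⟦⟧ᵗ-unpack (⊢snd d)    = ≡-snd (⟦⟧ᵗ-unpack d)
  -- monad X only computes for a concrete X.
  ⟦⟧ᵗ-unpack (⊢ret {X = 𝒮} d) = ≡-ret (⟦⟧ᵗ-unpack d)
  ⟦⟧ᵗ-unpack (⊢ret {X = 𝒯} d) = ≡-ret (⟦⟧ᵗ-unpack d)
  ⟦⟧ᵗ-unpack (⊢iota d)   = ≡-iota (⟦⟧ᵗ-unpack d)
  ⟦⟧ᵗ-unpack (⊢bind {X = 𝒮} {M = M} d e) =
    bind-unpack 𝒮 {M = M} (proj₂ ⟦ d ⟧ᵗ) (proj₂ ⟦ e ⟧ᵗ) e (⟦⟧ᵗ-unpack d) (⟦⟧ᵗ-unpack e)
  ⟦⟧ᵗ-unpack (⊢bind {X = 𝒯} {M = M} d e) =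
    bind-unpack 𝒯 {M = M} (proj₂ ⟦ d ⟧ᵗ) (proj₂ ⟦ e ⟧ᵗ) e (⟦⟧ᵗ-unpack d) (⟦⟧ᵗ-unpack e)
  ⟦⟧ᵗ-unpack (⊢conv p d) = ≡-conv ⟦ p ⟧≐ (⟦⟧ᵗ-unpack d)

  _⊢ʳ_∶_ : Ctx → (ℕ → ℕ) → Ctx → Set
  Δ ⊢ʳ ρ ∶ Γ = ∀ {n A} → Γ ∋ n ∶ A → Δ ∋ ρ n ∶ A

  tuple : Ctx → (ℕ → ℕ) → Term
  tuple []      ρ = ⋆
  tuple (B ∷ Γ) ρ = pair (tuple Γ (ρ ∘′ suc)) (var (ρ zero))

  ⊢tuple : ∀ {Γ Δ ρ} → Δ ⊢ʳ ρ ∶ Γ → Δ ⊢ tuple Γ ρ ∶ ⟦ Γ ⟧ᶜ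
  ⊢tuple {[]}    h = ⊢⋆
  ⊢tuple {B ∷ Γ} h = ⊢pair (⊢tuple (h ∘′ there)) (⊢conv (≐-sym (⟦⟧-≐ B)) (⊢var (h here)))

  unpack-tuple : ∀ {Γ Δ ρ} (h : Δ ⊢ʳ ρ ∶ Γ) → ∀ {n B} (x : Γ ∋ n ∶ B)
               → Δ ⊢ unpack Γ n [ tuple Γ ρ ]₀ ≡ var (ρ n) ∶ ⟦ B ⟧
  unpack-tuple {B ∷ Γ} h here = ≡-sndβ (⊢tuple (h ∘′ there)) (⊢conv (≐-sym (⟦⟧-≐ B)) (⊢var (h here)))
  unpack-tuple {C ∷ Γ} {ρ = ρ} h (there {n = n} x) = begin
    sub (σ₀ (tuple (C ∷ Γ) ρ)) (unpack Γ n [ fst v₀ ]₀)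
      ≡⟨ sub-sub₁ (σ₀ (tuple (C ∷ Γ) ρ)) (σ₀ (fst v₀)) (⊢unpack x) ⟩
    unpack Γ n [ fst (tuple (C ∷ Γ) ρ) ]₀
      ∼⟨ []₀-≡ (⊢unpack x) (≡-fstβ (⊢tuple (h ∘′ there)) (⊢conv (≐-sym (⟦⟧-≐ C)) (⊢var (h here)))) ⟩
    unpack Γ n [ tuple Γ (ρ ∘′ suc) ]₀
      ∼⟨ unpack-tuple (h ∘′ there) x ⟩
    var (ρ (suc n))
      ∎

  tuple-unpack : ∀ {Γ M A} → Γ ⊢ M ∶ A → Γ ⊢ sub (unpack Γ) M [ tuple Γ (λ n → n) ]₀ ≡ M ∶ A
  tuple-unpack {Γ} {M} d =
    sub-sub (σ₀ (tuple Γ (λ n → n))) (unpack Γ) M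
      ≣⟫ sub-≡ˢ {σ' = var} d (λ {_} {B} x → ≡-conv (⟦⟧-≐ B) (unpack-tuple (λ y → y) x)) ⟫≣ sub-id M

  type-equality⇔ : (A B : Type) → (A ≐ B) ⇔ (⟦ A ⟧ ≐ ⟦ B ⟧)
  type-equality⇔ A B = mk⇔ (λ p → ≐-trans (⟦⟧-≐ A) (≐-trans p (≐-sym (⟦⟧-≐ B))))
                           (λ p → ≐-trans (≐-sym (⟦⟧-≐ A)) (≐-trans p (⟦⟧-≐ B)))

  term-equality⇔ : ∀ {Γ M N A} (d : Γ ⊢ M ∶ A) (e : Γ ⊢ N ∶ A)
                 → (Γ ⊢ M ≡ N ∶ A) ⇔ ((⟦ Γ ⟧ᶜ ∷ []) ⊢ proj₁ ⟦ d ⟧ᵗ ≡ proj₁ ⟦ e ⟧ᵗ ∶ ⟦ A ⟧)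
  term-equality⇔ {A = A} d e = mk⇔ sound complete
    where
    sound : _ ⊢ _ ≡ _ ∶ A → _ ⊢ proj₁ ⟦ d ⟧ᵗ ≡ proj₁ ⟦ e ⟧ᵗ ∶ ⟦ A ⟧
    sound p = ⟦⟧ᵗ-unpack d ⟫ ≡-conv (≐-sym (⟦⟧-≐ A)) (≡-sub unpack-⊢ˢ p) ⟫ ≡-sym (⟦⟧ᵗ-unpack e)
    complete : _ ⊢ proj₁ ⟦ d ⟧ᵗ ≡ proj₁ ⟦ e ⟧ᵗ ∶ ⟦ A ⟧ → _ ⊢ _ ≡ _ ∶ A
    complete q = ≡-sym (tuple-unpack d)
               ⟫ ≡-conv (⟦⟧-≐ A) (≡-sub (single-⊢ˢ (⊢tuple (λ x → x))) (≡-sym (⟦⟧ᵗ-unpack d) ⟫ q ⟫ ⟦⟧ᵗ-unpack e))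
               ⟫ tuple-unpack e

mainTheorem13 : (Th : Theory) →
    let open Equality Th
        open Syntactic Th
        open CatData SynCat
    in Σ (IsCSCModel Syn) λ isM →
         let open Interpretation Th Syn isM
             open Sem (canonical isM)
         in ((A B : Type) → (A ≐ B) ⇔ (⟦ A ⟧ ≈ₒ ⟦ B ⟧))
            × (∀ {Γ M N A} (d : Γ ⊢ M ∶ A) (e : Γ ⊢ N ∶ A)
                 → (Γ ⊢ M ≡ N ∶ A) ⇔ (⟦ d ⟧ᵗ ≈ ⟦ e ⟧ᵗ))
mainTheorem13 Th = isCSCModel , type-equality⇔ , term-equality⇔
  where
  open SyntacticModel Th using (isCSCModel)
  open CanonicalInterpretation Th isCSCModel
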